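{- Let $d\ge1$ and let $\vec s=(s_1,\dots,s_d)$, $\vec t=(t_1,\dots,t_d)$ be vectors of integers such that all denominators below are nonzero. Then $$\sum_{\sigma,\tau\in\mathcal{S}_d}\frac{\mathrm{sgn}(\sigma)\,\mathrm{sgn}(\tau)}{\prod_{i=1}^d\big(d+1-i+\sum_{j=i}^d(s_{\sigma(j)}+t_{\tau(j)})\big)}=\prod_{1\le i<j\le d}(s_i-s_j)(t_i-t_j)\prod_{1\le i,j\le d}\frac{1}{1+s_i+t_j}.$$
   Context: $\mathcal{S}_d$ is the symmetric group on $\{1,\dots,d\}$ and $\mathrm{sgn}$ the sign of a permutation. -}

module Defs where

open import Data.Nat as ℕ using (ℕ; zero; suc)
open import Data.Integer as ℤ using (ℤ; +_; +[1+_]; -[1+_])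
open import Data.Rational as ℚ using (ℚ; 0ℚ; 1ℚ)
open import Data.Fin using (Fin; zero; suc; toℕ)
open import Data.Fin.Properties using (_≟_; _≤?_; _<?_)
open import Data.Bool using (Bool; true; false; _∧_; _∨_; not)
open import Data.List using (List; []; _∷_; concatMap; map; filter; foldr; allFin)
open import Data.Bool.ListAction using (and)
open import Data.Vec.Functional using () renaming (_∷_ to _◂_)
open import Relation.Nullary.Decidable using (⌊_⌋; does)
open import Relation.Unary using (Pred)

sumℤ : (n : ℕ) → (Fin n → ℤ) → ℤ
sumℤ zero    f = + 0
sumℤ (suc n) f = f zero ℤ.+ sumℤ n (λ i → f (suc i))

prodℤ : (n : ℕ) → (Fin n → ℤ) → ℤ
prodℤ zero    f = + 1
prodℤ (suc n) f = f zero ℤ.* prodℤ n (λ i → f (suc i))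

prodℚ : (n : ℕ) → (Fin n → ℚ) → ℚ
prodℚ zero    f = 1ℚ
prodℚ (suc n) f = f zero ℚ.* prodℚ n (λ i → f (suc i))

sumListℚ : List ℚ → ℚ
sumListℚ = foldr ℚ._+_ 0ℚ

toℚ : ℤ → ℚ
toℚ z = z ℚ./ 1

-- reciprocal of an integer as a rational (used only where the integer is nonzero;
-- it is given the junk value 0 at 0)
recip : ℤ → ℚ
recip (+ zero)    = 0ℚ
recip +[1+ n ]    = + 1 ℚ./ suc n
recip -[1+ n ]    = -[1+ 0 ] ℚ./ suc n

allFunctions : (n m : ℕ) → List (Fin n → Fin m)
allFunctions zero    m = (λ ()) ∷ []
allFunctions (suc n) m =
  concatMap (λ k → map (λ f → k ◂ f) (allFunctions n m)) (allFin m)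

isInjective : {d : ℕ} → (Fin d → Fin d) → Bool
isInjective {d} f =
  and (concatMap (λ i → map (λ j → does (i ≟ j) ∨ not (does (f i ≟ f j))) (allFin d)) (allFin d))

Sym : (d : ℕ) → List (Fin d → Fin d)
Sym d = filter (λ f → Data.Bool._≟_ (isInjective f) true) (allFunctions d d)
  where import Data.Bool

inversions : {d : ℕ} → (Fin d → Fin d) → ℕ
inversions {d} σ =
  Data.List.length (filter (λ p → (σ (Data.Product.proj₂ p)) <? (σ (Data.Product.proj₁ p)))
    (filter (λ p → Data.Product.proj₁ p <? Data.Product.proj₂ p)
      (concatMap (λ i → map (λ j → i Data.Product., j) (allFin d)) (allFin d))))
  where import Data.List; import Data.Product

sgn : {d : ℕ} → (Fin d → Fin d) → ℤ
sgn σ = (ℤ.- + 1) ℤ.^ inversions σ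

prodLtℤ : (d : ℕ) → (Fin d → Fin d → ℤ) → ℤ
prodLtℤ d g = prodℤ d (λ i → prodℤ d (λ j → if does (i <? j) then g i j else + 1))
  where open import Data.Bool using (if_then_else_)

-- the i-th denominator factor (i 0-indexed, i.e. i = i' - 1 for the paper's 1-indexed i'):
--   (d + 1 - i') + Σ_{j' = i'}^{d} (s_{σ(j')} + t_{τ(j')})
den : (d : ℕ) → (s t : Fin d → ℤ) → (σ τ : Fin d → Fin d) → Fin d → ℤ
den d s t σ τ i =
  + (d ℕ.∸ toℕ i) ℤ.+
  sumℤ d (λ j → if does (i ≤? j) then s (σ j) ℤ.+ t (τ j) else + 0)
  where open import Data.Bool using (if_then_else_)

lhs : (d : ℕ) → (s t : Fin d → ℤ) → ℚ
lhs d s t =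
  sumListℚ (concatMap (λ σ → map (λ τ →
      toℚ (sgn σ ℤ.* sgn τ) ℚ.* prodℚ d (λ i → recip (den d s t σ τ i)))
    (Sym d)) (Sym d))

rhs : (d : ℕ) → (s t : Fin d → ℤ) → ℚ
rhs d s t =
  toℚ (prodLtℤ d (λ i j → (s i ℤ.- s j) ℤ.* (t i ℤ.- t j))) ℚ.*
  prodℚ d (λ i → prodℚ d (λ j → recip (+ 1 ℤ.+ s i ℤ.+ t j)))

-- Put x = s and y = 1 + t. The right-hand side is Cauchy's determinant
--   C(x, y) = det (1 / (xᵢ + yⱼ)) = V(x) V(y) / ∏ᵢⱼ (xᵢ + yⱼ),  where V(x) = ∏_{i<j} (xᵢ - xⱼ).
-- On the left, the first denominator equals Σx + Σy for all σ, τ, and removing σ(1) and τ(1)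
-- turns the other denominators into those for d - 1 with x_{σ(1)} and y_{τ(1)} deleted, at the
-- cost of the signs (-1)^(σ(1)-1) and (-1)^(τ(1)-1). By induction on d it therefore suffices to
-- prove the expansion
--   Σ_{p,q} (-1)^(p+q) C(x∖p, y∖q) = (Σx + Σy) C(x, y).
-- Deleting xₚ and y_q divides the denominator of C by ∏_{l≠q} (xₚ + y_l) · ∏ᵢ (xᵢ + y_q), so the
-- sum over p is the Laplace expansion Σₚ (-1)^p V(x∖p) G(xₚ) of a Vandermonde-type determinant
-- whose last column is a monic polynomial G of degree d - 1. Such an expansion is V(x) times
-- the divided difference of G on the nodes x, here 1; what remains is the same expansion in y
-- of a monic polynomial of degree d, whose divided difference is Σy + Σx.

{-# OPTIONS --safe #-}
module Submission where

open import Defs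

-- The development uses ℚ's _+_ while the statement at the end uses ℤ's, so the development
-- lives in an anonymous module whose imports do not reach the statement.
module _ where

  open import Algebra.Bundles using (CommutativeMonoid; CommutativeRing)
  open import Data.Bool using (Bool; true; false; _∧_; _∨_; not; if_then_else_)
  open import Data.Bool.ListAction using (and)
  import Data.Bool.Properties as Bool
  open import Data.Empty using (⊥; ⊥-elim)
  open import Data.Fin as Fin using (Fin; zero; suc; toℕ; punchIn; punchOut)
  open import Data.Fin.Properties
    using (_≟_; _<?_; _≤?_; any?; all?; suc-injective; punchIn-injective; punchInᵢ≢i; punchIn-punchOut;
           punchOut-punchIn; punchOut-injective)
  open import Data.Integer as ℤ using (ℤ; -[1+_]; +[1+_])
  import Data.Integer.Properties as ℤ
  open import Data.List using (List; []; _∷_; _++_; map; concatMap; filter; allFin; tabulate; foldr)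
  open import Data.List.Membership.Propositional using (_∈_; lose)
  open import Data.List.Membership.Propositional.Properties
    using (∈-allFin; ∈-map⁺; ∈-map⁻; ∈-concatMap⁺; ∈-concatMap⁻; ∈-filter⁺; ∈-filter⁻)
  open import Data.List.Relation.Unary.Any using (here; there; satisfied)
  open import Data.Nat as ℕ using (ℕ; zero; suc)
  import Data.Nat.Coprimality as Coprime
  import Data.Nat.Properties as ℕ
  open import Data.Product using (∃; _×_; _,_; proj₁; proj₂)
  open import Data.Rational as ℚ using (ℚ; 0ℚ; 1ℚ; mkℚ; _+_; _*_; -_; _-_)
  import Data.Rational.Properties as ℚ
  open import Data.Sum using (_⊎_; inj₁; inj₂)
  open import Data.Vec.Functional using (Vector; removeAt) renaming (_∷_ to _◂_)
  open import Function using (id; _∘_; Injective; _⇔_; mk⇔; Equivalence)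
  open import Relation.Binary using (DecidableEquality)
  open import Relation.Binary.PropositionalEquality
    using (_≡_; _≢_; _≗_; refl; sym; trans; cong; cong₂; module ≡-Reasoning)
  open import Relation.Nullary using (Dec; yes; no; does; ¬?; _×-dec_)
  open import Relation.Nullary.Decidable using (dec⇒maybe; decidable-stable; dec-true; dec-false; does-⇔)
  open import Relation.Unary using (Pred; Decidable)
  open import Tactic.RingSolver using (solve-∀)
  open import Tactic.RingSolver.Core.AlmostCommutativeRing using (AlmostCommutativeRing; fromCommutativeRing)

  module FiniteSums {c ℓ} (M : CommutativeMonoid c ℓ) where

    open CommutativeMonoid M
      using (Carrier; _≈_; _∙_; ε; setoid; ∙-cong; ∙-congˡ; assoc; identityˡ)
      renaming (refl to ≈-refl; sym to ≈-sym; trans to ≈-trans)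
    open import Algebra.Properties.CommutativeMonoid.Sum M
      using (sum; sum-cong-≗; sum-remove; sum-replicate-zero; ∑-distrib-+)
    open import Relation.Binary.Reasoning.Setoid setoid

    sum-reindex : ∀ {n} (σ : Fin n → Fin n) → Injective _≡_ _≡_ σ → (f : Vector Carrier n) →
                  sum (f ∘ σ) ≈ sum f
    sum-reindex {zero}  σ σ-inj f = ≈-refl
    sum-reindex {suc n} σ σ-inj f = begin
      f (σ zero) ∙ sum (f ∘ σ ∘ suc)
        ≡⟨ cong (f (σ zero) ∙_) (sum-cong-≗ λ i → cong f (punchIn-punchOut (σ₀≢σ i))) ⟨
      f (σ zero) ∙ sum (f ∘ punchIn (σ zero) ∘ σ′)
        ≈⟨ ∙-congˡ (sum-reindex σ′ σ′-inj (f ∘ punchIn (σ zero))) ⟩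
      f (σ zero) ∙ sum (f ∘ punchIn (σ zero))
        ≈⟨ sum-remove f ⟨
      sum f
        ∎
      where
      σ₀≢σ : ∀ i → σ zero ≢ σ (suc i)
      σ₀≢σ i eq with () ← σ-inj eq
      σ′ : Fin n → Fin n
      σ′ i = punchOut (σ₀≢σ i)
      σ′-inj : Injective _≡_ _≡_ σ′
      σ′-inj eq = suc-injective (σ-inj (punchOut-injective (σ₀≢σ _) (σ₀≢σ _) eq))

    sumOver : ∀ {a} {A : Set a} → List A → (A → Carrier) → Carrier
    sumOver xs f = foldr (λ x s → f x ∙ s) ε xs

    module _ {a} {A : Set a} where

      sumOver-++ : ∀ (xs ys : List A) f → sumOver (xs ++ ys) f ≈ sumOver xs f ∙ sumOver ys f
      sumOver-++ []       ys f = ≈-sym (identityˡ _)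
      sumOver-++ (x ∷ xs) ys f = ≈-trans (∙-congˡ (sumOver-++ xs ys f)) (≈-sym (assoc _ _ _))

      sumOver-cong-∈ : ∀ (xs : List A) {f g} → (∀ {x} → x ∈ xs → f x ≈ g x) → sumOver xs f ≈ sumOver xs g
      sumOver-cong-∈ []       f≈g = ≈-refl
      sumOver-cong-∈ (x ∷ xs) f≈g = ∙-cong (f≈g (here refl)) (sumOver-cong-∈ xs (f≈g ∘ there))

      sumOver-ε : ∀ (xs : List A) → sumOver xs (λ _ → ε) ≈ ε
      sumOver-ε []       = ≈-refl
      sumOver-ε (x ∷ xs) = ≈-trans (∙-congˡ (sumOver-ε xs)) (identityˡ ε)

      sumOver-filter : ∀ {p} {P : Pred A p} (P? : Decidable P) xs f →
                       sumOver (filter P? xs) f ≈ sumOver xs (λ x → if does (P? x) then f x else ε)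
      sumOver-filter P? []       f = ≈-refl
      sumOver-filter P? (x ∷ xs) f with does (P? x)
      ... | true  = ∙-congˡ (sumOver-filter P? xs f)
      ... | false = ≈-trans (sumOver-filter P? xs f) (≈-sym (identityˡ _))

      sumOver-∑-comm : ∀ {n} (xs : List A) (f : A → Vector Carrier n) →
                       sumOver xs (λ x → sum (f x)) ≈ sum (λ k → sumOver xs (λ x → f x k))
      sumOver-∑-comm {n} []       f = ≈-sym (sum-replicate-zero n)
      sumOver-∑-comm     (x ∷ xs) f = ≈-trans (∙-congˡ (sumOver-∑-comm xs f)) (≈-sym (∑-distrib-+ (f x) _))

    module _ {a b} {A : Set a} {B : Set b} where

      sumOver-map : ∀ (h : A → B) xs f → sumOver (map h xs) f ≡ sumOver xs (f ∘ h)
      sumOver-map h []       f = refl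
      sumOver-map h (x ∷ xs) f = cong (f (h x) ∙_) (sumOver-map h xs f)

      sumOver-concatMap : ∀ (g : A → List B) xs f → sumOver (concatMap g xs) f ≈ sumOver xs (λ x → sumOver (g x) f)
      sumOver-concatMap g []       f = ≈-refl
      sumOver-concatMap g (x ∷ xs) f = ≈-trans (sumOver-++ (g x) (concatMap g xs) f) (∙-congˡ (sumOver-concatMap g xs f))

    sumOver-tabulate : ∀ {a} {A : Set a} {n} (g : Fin n → A) f → sumOver (tabulate g) f ≈ sum (f ∘ g)
    sumOver-tabulate {n = zero}  g f = ≈-refl
    sumOver-tabulate {n = suc n} g f = ∙-congˡ (sumOver-tabulate (g ∘ suc) f)

    sumOver-allFin : ∀ n f → sumOver (allFin n) f ≈ sum f
    sumOver-allFin n = sumOver-tabulate id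

  open ≡-Reasoning

  ℚ-ring : AlmostCommutativeRing _ _
  ℚ-ring = fromCommutativeRing ℚ.+-*-commutativeRing (λ x → dec⇒maybe (0ℚ ℚ.≟ x))

  -- Total inverse, with the junk value 0 at 0 (as for recip).
  _⁻¹ : ℚ → ℚ
  p ⁻¹ with p ℚ.≟ 0ℚ
  ... | yes _   = 0ℚ
  ... | no p≢0 = ℚ.1/_ p {{ℚ.≢-nonZero p≢0}}

  ⁻¹-inverseʳ : ∀ {p} → p ≢ 0ℚ → p * p ⁻¹ ≡ 1ℚ
  ⁻¹-inverseʳ {p} p≢0 with p ℚ.≟ 0ℚ
  ... | yes p≡0 = ⊥-elim (p≢0 p≡0)
  ... | no p≢0′ = ℚ.*-inverseʳ p {{ℚ.≢-nonZero p≢0′}}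

  ⁻¹-inverseˡ : ∀ {p} → p ≢ 0ℚ → p ⁻¹ * p ≡ 1ℚ
  ⁻¹-inverseˡ {p} p≢0 = trans (ℚ.*-comm (p ⁻¹) p) (⁻¹-inverseʳ p≢0)

  *-cancelˡ : ∀ {c a b} → c ≢ 0ℚ → c * a ≡ c * b → a ≡ b
  *-cancelˡ {c} {a} {b} c≢0 ca≡cb = begin
    a                ≡⟨ ℚ.*-identityˡ a ⟨
    1ℚ * a           ≡⟨ cong (_* a) (⁻¹-inverseˡ c≢0) ⟨
    (c ⁻¹ * c) * a   ≡⟨ ℚ.*-assoc (c ⁻¹) c a ⟩
    c ⁻¹ * (c * a)   ≡⟨ cong (c ⁻¹ *_) ca≡cb ⟩
    c ⁻¹ * (c * b)   ≡⟨ ℚ.*-assoc (c ⁻¹) c b ⟨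
    (c ⁻¹ * c) * b   ≡⟨ cong (_* b) (⁻¹-inverseˡ c≢0) ⟩
    1ℚ * b           ≡⟨ ℚ.*-identityˡ b ⟩
    b                ∎

  *-≢0 : ∀ {p q} → p ≢ 0ℚ → q ≢ 0ℚ → p * q ≢ 0ℚ
  *-≢0 {p} {q} p≢0 q≢0 pq≡0 = q≢0 (*-cancelˡ p≢0 (trans pq≡0 (sym (ℚ.*-zeroʳ p))))

  ⁻¹-unique : ∀ {p q} → p * q ≡ 1ℚ → p ⁻¹ ≡ q
  ⁻¹-unique {p} {q} pq≡1 = *-cancelˡ p≢0 (trans (⁻¹-inverseʳ p≢0) (sym pq≡1))
    where
    p≢0 : p ≢ 0ℚ
    p≢0 p≡0 = ℚ.1≢0 (trans (sym pq≡1) (trans (cong (_* q) p≡0) (ℚ.*-zeroˡ q)))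

  ⁻¹-distrib-* : ∀ p q → (p * q) ⁻¹ ≡ p ⁻¹ * q ⁻¹
  ⁻¹-distrib-* p q = by-cases (p ℚ.≟ 0ℚ) (q ℚ.≟ 0ℚ)
    where
    interchange : ∀ a b c d → (a * b) * (c * d) ≡ (a * c) * (b * d)
    interchange = solve-∀ ℚ-ring

    by-cases : Dec (p ≡ 0ℚ) → Dec (q ≡ 0ℚ) → (p * q) ⁻¹ ≡ p ⁻¹ * q ⁻¹
    by-cases (yes refl) _ = trans (cong _⁻¹ (ℚ.*-zeroˡ q)) (sym (ℚ.*-zeroˡ (q ⁻¹)))
    by-cases (no _) (yes refl) = trans (cong _⁻¹ (ℚ.*-zeroʳ p)) (sym (ℚ.*-zeroʳ (p ⁻¹)))
    by-cases (no p≢0) (no q≢0) = ⁻¹-unique {p * q} (begin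
      (p * q) * (p ⁻¹ * q ⁻¹)    ≡⟨ interchange p q (p ⁻¹) (q ⁻¹) ⟩
      (p * p ⁻¹) * (q * q ⁻¹)    ≡⟨ cong₂ _*_ (⁻¹-inverseʳ p≢0) (⁻¹-inverseʳ q≢0) ⟩
      1ℚ                         ∎)

  ⁻¹-*-cancelˡ : ∀ {p} q → p ≢ 0ℚ → p ⁻¹ * (p * q) ≡ q
  ⁻¹-*-cancelˡ {p} q p≢0 = begin
    p ⁻¹ * (p * q)    ≡⟨ ℚ.*-assoc (p ⁻¹) p q ⟨
    (p ⁻¹ * p) * q    ≡⟨ cong (_* q) (⁻¹-inverseˡ p≢0) ⟩
    1ℚ * q            ≡⟨ ℚ.*-identityˡ q ⟩
    q                 ∎

  cancel-common-factor : ∀ {c} a b → c ≢ 0ℚ → (c * a) * (c * b) ⁻¹ ≡ a * b ⁻¹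
  cancel-common-factor {c} a b c≢0 = begin
    (c * a) * (c * b) ⁻¹        ≡⟨ cong ((c * a) *_) (⁻¹-distrib-* c b) ⟩
    (c * a) * (c ⁻¹ * b ⁻¹)     ≡⟨ regroup c a (c ⁻¹) (b ⁻¹) ⟩
    (c * c ⁻¹) * (a * b ⁻¹)     ≡⟨ cong (_* (a * b ⁻¹)) (⁻¹-inverseʳ c≢0) ⟩
    1ℚ * (a * b ⁻¹)             ≡⟨ ℚ.*-identityˡ _ ⟩
    a * b ⁻¹                    ∎
    where
    regroup : ∀ c a d e → (c * a) * (d * e) ≡ (c * d) * (a * e)
    regroup = solve-∀ ℚ-ring

  ≢⇒-≢0 : ∀ {a b} → a ≢ b → a - b ≢ 0ℚ
  ≢⇒-≢0 {a} {b} a≢b a-b≡0 = a≢b (begin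
    a                ≡⟨ subtract-add a b ⟩
    (a - b) + b      ≡⟨ cong (_+ b) a-b≡0 ⟩
    0ℚ + b           ≡⟨ ℚ.+-identityˡ b ⟩
    b                ∎)
    where
    subtract-add : ∀ a b → a ≡ (a - b) + b
    subtract-add = solve-∀ ℚ-ring

  toℚ≡mkℚ : ∀ z → toℚ z ≡ mkℚ z 0 (Coprime.sym (Coprime.1-coprimeTo ℤ.∣ z ∣))
  toℚ≡mkℚ (ℤ.+ n)  = ℚ.normalize-coprime (Coprime.sym (Coprime.1-coprimeTo n))
  toℚ≡mkℚ -[1+ n ] = cong -_ (ℚ.normalize-coprime (Coprime.sym (Coprime.1-coprimeTo (suc n))))

  toℚ-injective : ∀ {a b} → toℚ a ≡ toℚ b → a ≡ b
  toℚ-injective {a} {b} eq = cong ℚ.numerator (trans (sym (toℚ≡mkℚ a)) (trans eq (toℚ≡mkℚ b)))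

  toℚ-+ : ∀ a b → toℚ (a ℤ.+ b) ≡ toℚ a + toℚ b
  toℚ-+ a b rewrite toℚ≡mkℚ a | toℚ≡mkℚ b =
    cong toℚ (cong₂ ℤ._+_ (sym (ℤ.*-identityʳ a)) (sym (ℤ.*-identityʳ b)))

  toℚ-* : ∀ a b → toℚ (a ℤ.* b) ≡ toℚ a * toℚ b
  toℚ-* a b rewrite toℚ≡mkℚ a | toℚ≡mkℚ b = refl

  toℚ-neg : ∀ a → toℚ (ℤ.- a) ≡ - toℚ a
  toℚ-neg a = begin
    toℚ (ℤ.- a)               ≡⟨ cong toℚ (ℤ.-1*i≡-i a) ⟨
    toℚ (ℤ.-1ℤ ℤ.* a)         ≡⟨ toℚ-* ℤ.-1ℤ a ⟩
    toℚ ℤ.-1ℤ * toℚ a         ≡⟨ ℚ.neg-distribˡ-* 1ℚ (toℚ a) ⟨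
    - (1ℚ * toℚ a)            ≡⟨ cong -_ (ℚ.*-identityˡ (toℚ a)) ⟩
    - toℚ a                   ∎

  toℚ-minus : ∀ a b → toℚ (a ℤ.- b) ≡ toℚ a - toℚ b
  toℚ-minus a b = trans (toℚ-+ a (ℤ.- b)) (cong (λ w → toℚ a + w) (toℚ-neg b))

  recip≡toℚ⁻¹ : ∀ z → recip z ≡ toℚ z ⁻¹
  recip≡toℚ⁻¹ (ℤ.+ zero) = refl
  recip≡toℚ⁻¹ +[1+ n ]  =
    trans (ℚ.normalize-coprime (Coprime.1-coprimeTo (suc n))) (cong _⁻¹ (sym (toℚ≡mkℚ +[1+ n ])))
  recip≡toℚ⁻¹ -[1+ n ]  =
    trans (cong -_ (ℚ.normalize-coprime (Coprime.1-coprimeTo (suc n)))) (cong _⁻¹ (sym (toℚ≡mkℚ -[1+ n ])))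

  open import Algebra.Properties.Semiring.Sum (CommutativeRing.semiring ℚ.+-*-commutativeRing)
    using (sum; sum-syntax; sum-cong-≗; sum-remove; sum-replicate-zero; ∑-distrib-+; ∑-comm; *-distribˡ-sum)
  open import Algebra.Properties.CommutativeMonoid.Sum ℚ.*-1-commutativeMonoid
    using () renaming (sum to ∏; sum-cong-≗ to ∏-cong; sum-remove to ∏-remove; ∑-distrib-+ to ∏-distrib-*)
  open FiniteSums ℚ.+-0-commutativeMonoid

  sumOver-*ˡ : ∀ {a} {A : Set a} c (xs : List A) f → c * sumOver xs f ≡ sumOver xs (λ x → c * f x)
  sumOver-*ˡ c []       f = ℚ.*-zeroʳ c
  sumOver-*ˡ c (x ∷ xs) f = trans (ℚ.*-distribˡ-+ c (f x) _) (cong (c * f x +_) (sumOver-*ˡ c xs f))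

  sumOver-if : ∀ {a} {A : Set a} b (xs : List A) f →
               sumOver xs (λ x → if b then f x else 0ℚ) ≡ (if b then sumOver xs f else 0ℚ)
  sumOver-if true  xs f = refl
  sumOver-if false xs f = sumOver-ε xs

  if-∧ : ∀ a b (x : ℚ) → (if a ∧ b then x else 0ℚ) ≡ (if a then (if b then x else 0ℚ) else 0ℚ)
  if-∧ true  b x = refl
  if-∧ false b x = refl

  sum-except : ∀ {m} (k : Fin (suc m)) (f : Vector ℚ (suc m)) →
               ∑[ c < suc m ] (if not (does (c ≟ k)) then f c else 0ℚ) ≡ sum (removeAt f k)
  sum-except k f = begin
    ∑[ c < _ ] g c                 ≡⟨ sum-remove {i = k} g ⟩
    g k + sum (removeAt g k)       ≡⟨ cong₂ _+_ gk≡0 (sum-cong-≗ g-punchIn) ⟩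
    0ℚ + sum (removeAt f k)        ≡⟨ ℚ.+-identityˡ _ ⟩
    sum (removeAt f k)             ∎
    where
    g : Vector ℚ _
    g c = if not (does (c ≟ k)) then f c else 0ℚ
    gk≡0 : g k ≡ 0ℚ
    gk≡0 rewrite dec-true (k ≟ k) refl = refl
    g-punchIn : ∀ c → g (punchIn k c) ≡ f (punchIn k c)
    g-punchIn c rewrite dec-false (punchIn k c ≟ k) (punchInᵢ≢i k c) = refl

  sum-vanishing-off-pair : ∀ {n} (f : Vector ℚ (suc n)) {a b} → a ≢ b → (∀ p → p ≢ a → p ≢ b → f p ≡ 0ℚ) →
                           f a + f b ≡ 0ℚ → sum f ≡ 0ℚ
  sum-vanishing-off-pair {zero}  f {zero} {zero} a≢b _ _ = ⊥-elim (a≢b refl)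
  sum-vanishing-off-pair {suc n} f {a} {b} a≢b f-off fa+fb≡0 = begin
    sum f                                                    ≡⟨ sum-remove {i = a} f ⟩
    f a + sum (removeAt f a)                                 ≡⟨ cong (f a +_) (sum-remove {i = b′} (removeAt f a)) ⟩
    f a + (f (punchIn a b′) + sum (removeAt (removeAt f a) b′))
      ≡⟨ cong₂ (λ u v → f a + (f u + v)) (punchIn-punchOut a≢b) (trans (sum-cong-≗ rest≡0) (sum-replicate-zero n)) ⟩
    f a + (f b + 0ℚ)                                         ≡⟨ cong (f a +_) (ℚ.+-identityʳ (f b)) ⟩
    f a + f b                                                ≡⟨ fa+fb≡0 ⟩
    0ℚ                                                       ∎
    where
    b′ = punchOut a≢b
    rest≡0 : ∀ k → f (punchIn a (punchIn b′ k)) ≡ 0ℚ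
    rest≡0 k = f-off _ (punchInᵢ≢i a _)
      (λ eq → punchInᵢ≢i b′ k (punchIn-injective a _ _ (trans eq (sym (punchIn-punchOut a≢b)))))

  ∏-zero : ∀ {n} (f : Vector ℚ n) k → f k ≡ 0ℚ → ∏ f ≡ 0ℚ
  ∏-zero f zero    fk≡0 = trans (cong (_* ∏ (f ∘ suc)) fk≡0) (ℚ.*-zeroˡ (∏ (f ∘ suc)))
  ∏-zero f (suc k) fk≡0 = trans (cong (f zero *_) (∏-zero (f ∘ suc) k fk≡0)) (ℚ.*-zeroʳ (f zero))

  ∏-≢0 : ∀ {n} (f : Vector ℚ n) → (∀ i → f i ≢ 0ℚ) → ∏ f ≢ 0ℚ
  ∏-≢0 {zero}  f f≢0 = ℚ.1≢0
  ∏-≢0 {suc n} f f≢0 = *-≢0 (f≢0 zero) (∏-≢0 (f ∘ suc) (f≢0 ∘ suc))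

  ⁻¹-∏ : ∀ {n} (f : Vector ℚ n) → ∏ f ⁻¹ ≡ ∏ (λ i → f i ⁻¹)
  ⁻¹-∏ {zero}  f = refl
  ⁻¹-∏ {suc n} f = trans (⁻¹-distrib-* (f zero) _) (cong (f zero ⁻¹ *_) (⁻¹-∏ (f ∘ suc)))

  ∏²-remove : ∀ {n} (g : Fin (suc n) → Fin (suc n) → ℚ) p q →
              ∏ (λ i → ∏ (g i))
                ≡ (∏ (λ j → g p (punchIn q j)) * ∏ (λ i → g i q)) * ∏ (λ i → ∏ (λ j → g (punchIn p i) (punchIn q j)))
  ∏²-remove g p q = begin
    ∏ (λ i → ∏ (g i))
      ≡⟨ ∏-remove {i = p} (λ i → ∏ (g i)) ⟩
    ∏ (g p) * ∏ (λ i → ∏ (g (punchIn p i)))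
      ≡⟨ cong₂ _*_ (∏-remove {i = q} (g p)) (∏-cong (λ i → ∏-remove {i = q} (g (punchIn p i)))) ⟩
    (g p q * R) * ∏ (λ i → g (punchIn p i) q * ∏ (λ j → g (punchIn p i) (punchIn q j)))
      ≡⟨ cong ((g p q * R) *_) (∏-distrib-* (λ i → g (punchIn p i) q) (λ i → ∏ (λ j → g (punchIn p i) (punchIn q j)))) ⟩
    (g p q * R) * (∏ (λ i → g (punchIn p i) q) * M)
      ≡⟨ regroup (g p q) R (∏ (λ i → g (punchIn p i) q)) M ⟩
    (R * (g p q * ∏ (λ i → g (punchIn p i) q))) * M
      ≡⟨ cong (λ w → (R * w) * M) (∏-remove {i = p} (λ i → g i q)) ⟨
    (R * ∏ (λ i → g i q)) * M
      ∎
    where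
    R = ∏ (λ j → g p (punchIn q j))
    M = ∏ (λ i → ∏ (λ j → g (punchIn p i) (punchIn q j)))
    regroup : ∀ a r c m → (a * r) * (c * m) ≡ (r * (a * c)) * m
    regroup = solve-∀ ℚ-ring

  ∏< : ∀ {n} → (Fin n → Fin n → ℚ) → ℚ
  ∏< g = ∏ (λ i → ∏ (λ j → if does (i <? j) then g i j else 1ℚ))

  ∏<-suc : ∀ {n} (g : Fin (suc n) → Fin (suc n) → ℚ) →
           ∏< g ≡ ∏ (λ j → g zero (suc j)) * ∏< (λ i j → g (suc i) (suc j))
  ∏<-suc g = cong₂ _*_ (ℚ.*-identityˡ (∏ (λ j → g zero (suc j))))
                       (∏-cong (λ i → ℚ.*-identityˡ (∏ (λ j → if does (i <? j) then g (suc i) (suc j) else 1ℚ))))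

  ∏<-cong : ∀ {n} {f g : Fin n → Fin n → ℚ} → (∀ i j → f i j ≡ g i j) → ∏< f ≡ ∏< g
  ∏<-cong f≗g = ∏-cong (λ i → ∏-cong (λ j → cong (λ w → if does (i <? j) then w else 1ℚ) (f≗g i j)))

  ∏<-distrib-* : ∀ {n} (f g : Fin n → Fin n → ℚ) → ∏< (λ i j → f i j * g i j) ≡ ∏< f * ∏< g
  ∏<-distrib-* {n} f g = begin
    ∏< (λ i j → f i j * g i j)
      ≡⟨ ∏-cong (λ i → trans (∏-cong (λ j → if-* (does (i <? j)) (f i j) (g i j))) (∏-distrib-* (upper f i) (upper g i))) ⟩
    ∏ (λ i → ∏ (upper f i) * ∏ (upper g i))
      ≡⟨ ∏-distrib-* (∏ ∘ upper f) (∏ ∘ upper g) ⟩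
    ∏< f * ∏< g
      ∎
    where
    upper : (Fin n → Fin n → ℚ) → Fin n → Fin n → ℚ
    upper h i j = if does (i <? j) then h i j else 1ℚ
    if-* : ∀ b u v → (if b then u * v else 1ℚ) ≡ (if b then u else 1ℚ) * (if b then v else 1ℚ)
    if-* true  u v = refl
    if-* false u v = refl

  -- Divided differences

  punchIn-punchOut-comm : ∀ {n} {a b : Fin (suc (suc n))} (a≢b : a ≢ b) (b≢a : b ≢ a) k →
                          punchIn a (punchIn (punchOut a≢b) k) ≡ punchIn b (punchIn (punchOut b≢a) k)
  punchIn-punchOut-comm {a = zero}  {zero}  a≢b b≢a k       = ⊥-elim (a≢b refl)
  punchIn-punchOut-comm {a = zero}  {suc b} a≢b b≢a k       = refl
  punchIn-punchOut-comm {a = suc a} {zero}  a≢b b≢a k       = refl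
  punchIn-punchOut-comm {a = suc a} {suc b} a≢b b≢a zero    = refl
  punchIn-punchOut-comm {a = suc a} {suc b} a≢b b≢a (suc k) =
    cong suc (punchIn-punchOut-comm (a≢b ∘ cong suc) (b≢a ∘ cong suc) k)

  removeAt-injective : ∀ {a} {A : Set a} {n} (x : Vector A (suc n)) → Injective _≡_ _≡_ x → ∀ p →
                       Injective _≡_ _≡_ (removeAt x p)
  removeAt-injective x x-inj p eq = punchIn-injective p _ _ (x-inj eq)

  -- ω′ x p is the derivative at x p of ∏ᵢ (z - x i), so divDiff x h is the divided
  -- difference [x₀, …, xₙ] h written in Lagrange form.
  ω′ : ∀ {n} → Vector ℚ (suc n) → Fin (suc n) → ℚ
  ω′ x p = ∏ (λ i → x p - removeAt x p i)

  divDiff : ∀ {n} → Vector ℚ (suc n) → (ℚ → ℚ) → ℚ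
  divDiff x h = ∑[ p < _ ] (h (x p) * ω′ x p ⁻¹)

  ω′-≢0 : ∀ {n} (x : Vector ℚ (suc n)) → Injective _≡_ _≡_ x → ∀ p → ω′ x p ≢ 0ℚ
  ω′-≢0 x x-inj p = ∏-≢0 _ (λ i → ≢⇒-≢0 (λ eq → punchInᵢ≢i p i (x-inj (sym eq))))

  ω′-punchIn : ∀ {n} (x : Vector ℚ (suc (suc n))) q j →
               ω′ x (punchIn q j) ≡ (x (punchIn q j) - x q) * ω′ (removeAt x q) j
  ω′-punchIn x q j = begin
    ∏ (λ i → x p - x (punchIn p i))
      ≡⟨ ∏-remove {i = punchOut p≢q} (λ i → x p - x (punchIn p i)) ⟩
    (x p - x (punchIn p (punchOut p≢q))) * ∏ (λ k → x p - x (punchIn p (punchIn (punchOut p≢q) k)))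
      ≡⟨ cong₂ (λ u v → (x p - x u) * v) (punchIn-punchOut p≢q)
               (∏-cong (λ k → cong (λ w → x p - x w) (punchIn-removed k))) ⟩
    (x p - x q) * ∏ (λ k → x p - x (punchIn q (punchIn j k)))
      ∎
    where
    p = punchIn q j
    p≢q : p ≢ q
    p≢q = punchInᵢ≢i q j
    punchIn-removed : ∀ k → punchIn p (punchIn (punchOut p≢q) k) ≡ punchIn q (punchIn j k)
    punchIn-removed k = trans (punchIn-punchOut-comm p≢q (p≢q ∘ sym) k)
                              (cong (λ w → punchIn q (punchIn w k)) (punchOut-punchIn q))

  divDiff-removeAt : ∀ {n} (x : Vector ℚ (suc (suc n))) → Injective _≡_ _≡_ x → ∀ q h →
                     divDiff x (λ z → (z - x q) * h z) ≡ divDiff (removeAt x q) h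
  divDiff-removeAt x x-inj q h = begin
    divDiff x (λ z → (z - x q) * h z)
      ≡⟨ sum-remove {i = q} (λ p → ((x p - x q) * h (x p)) * ω′ x p ⁻¹) ⟩
    ((x q - x q) * h (x q)) * ω′ x q ⁻¹ + ∑[ j < _ ] term j
      ≡⟨ cong₂ _+_ (vanishes (x q) (h (x q)) (ω′ x q ⁻¹)) (sum-cong-≗ term-removeAt) ⟩
    0ℚ + divDiff (removeAt x q) h
      ≡⟨ ℚ.+-identityˡ _ ⟩
    divDiff (removeAt x q) h
      ∎
    where
    vanishes : ∀ a b c → ((a - a) * b) * c ≡ 0ℚ
    vanishes = solve-∀ ℚ-ring
    term : Fin _ → ℚ
    term j = ((x (punchIn q j) - x q) * h (x (punchIn q j))) * ω′ x (punchIn q j) ⁻¹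
    term-removeAt : ∀ j → term j ≡ h (x (punchIn q j)) * ω′ (removeAt x q) j ⁻¹
    term-removeAt j = trans (cong (λ w → ((x (punchIn q j) - x q) * h (x (punchIn q j))) * w ⁻¹) (ω′-punchIn x q j))
                   (cancel-common-factor _ _ (≢⇒-≢0 (λ eq → punchInᵢ≢i q j (x-inj eq))))

  divDiff-cong : ∀ {n} (x : Vector ℚ (suc n)) {f g} → (∀ z → f z ≡ g z) → divDiff x f ≡ divDiff x g
  divDiff-cong x f≗g = sum-cong-≗ (λ p → cong (_* ω′ x p ⁻¹) (f≗g (x p)))

  divDiff-+ : ∀ {n} (x : Vector ℚ (suc n)) f g → divDiff x (λ z → f z + g z) ≡ divDiff x f + divDiff x g
  divDiff-+ x f g = trans (sum-cong-≗ (λ p → ℚ.*-distribʳ-+ (ω′ x p ⁻¹) (f (x p)) (g (x p))))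
                          (∑-distrib-+ (λ p → f (x p) * ω′ x p ⁻¹) (λ p → g (x p) * ω′ x p ⁻¹))

  divDiff-*ˡ : ∀ {n} (x : Vector ℚ (suc n)) c f → divDiff x (λ z → c * f z) ≡ c * divDiff x f
  divDiff-*ˡ x c f = trans (sum-cong-≗ (λ p → ℚ.*-assoc c (f (x p)) (ω′ x p ⁻¹)))
                           (sym (*-distribˡ-sum c (λ p → f (x p) * ω′ x p ⁻¹)))

  -- (x₁ - x₀) times the divided difference of 1 is the difference of the divided differences of 1
  -- on x without x₀ and on x without x₁, and these agree by induction.
  divDiff-one : ∀ {n} (x : Vector ℚ (suc (suc n))) → Injective _≡_ _≡_ x → divDiff x (λ _ → 1ℚ) ≡ 0ℚ
  divDiff-one {n} x x-inj = *-cancelˡ (≢⇒-≢0 x₁≢x₀) (begin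
    (x₁ - x₀) * D                                        ≡⟨ difference (divDiff x∖₁ one) ((x₁ - x₀) * D) ⟩
    (divDiff x∖₁ one + (x₁ - x₀) * D) - divDiff x∖₁ one  ≡⟨ cong (_- divDiff x∖₁ one) split ⟨
    divDiff x∖₀ one - divDiff x∖₁ one                    ≡⟨ cong (_- divDiff x∖₁ one) removals-agree ⟩
    divDiff x∖₁ one - divDiff x∖₁ one                    ≡⟨ ℚ.+-inverseʳ (divDiff x∖₁ one) ⟩
    0ℚ                                                   ≡⟨ ℚ.*-zeroʳ (x₁ - x₀) ⟨
    (x₁ - x₀) * 0ℚ                                       ∎)
    where
    one : ℚ → ℚ
    one _ = 1ℚ
    x₀ = x zero
    x₁ = x (suc zero)
    x∖₀ = removeAt x zero
    x∖₁ = removeAt x (suc zero)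
    D = divDiff x one
    x₁≢x₀ : x₁ ≢ x₀
    x₁≢x₀ eq with () ← x-inj eq
    difference : ∀ a b → b ≡ (a + b) - a
    difference = solve-∀ ℚ-ring
    regroup : ∀ z a b → (z - a) * 1ℚ ≡ (z - b) * 1ℚ + (b - a) * 1ℚ
    regroup = solve-∀ ℚ-ring
    split : divDiff x∖₀ one ≡ divDiff x∖₁ one + (x₁ - x₀) * D
    split = begin
      divDiff x∖₀ one
        ≡⟨ divDiff-removeAt x x-inj zero one ⟨
      divDiff x (λ z → (z - x₀) * 1ℚ)
        ≡⟨ divDiff-cong x (λ z → regroup z x₀ x₁) ⟩
      divDiff x (λ z → (z - x₁) * 1ℚ + (x₁ - x₀) * 1ℚ)
        ≡⟨ divDiff-+ x (λ z → (z - x₁) * 1ℚ) (λ _ → (x₁ - x₀) * 1ℚ) ⟩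
      divDiff x (λ z → (z - x₁) * 1ℚ) + divDiff x (λ z → (x₁ - x₀) * 1ℚ)
        ≡⟨ cong₂ _+_ (divDiff-removeAt x x-inj (suc zero) one) (divDiff-*ˡ x (x₁ - x₀) one) ⟩
      divDiff x∖₁ one + (x₁ - x₀) * D
        ∎
    agree : ∀ m (u v : Vector ℚ (suc m)) → Injective _≡_ _≡_ u → Injective _≡_ _≡_ v → divDiff u one ≡ divDiff v one
    agree zero    u v _     _     = refl
    agree (suc m) u v u-inj v-inj = trans (divDiff-one u u-inj) (sym (divDiff-one v v-inj))
    removals-agree : divDiff x∖₀ one ≡ divDiff x∖₁ one
    removals-agree = agree n x∖₀ x∖₁ (removeAt-injective x x-inj zero) (removeAt-injective x x-inj (suc zero))

  monicPoly : ∀ {k} → Vector ℚ k → ℚ → ℚ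
  monicPoly c z = ∏ (λ l → z + c l)

  divDiff-monicPoly-step : ∀ {n k} (x : Vector ℚ (suc (suc n))) → Injective _≡_ _≡_ x → (c : Vector ℚ (suc k)) →
    divDiff x (monicPoly c)
      ≡ divDiff (removeAt x zero) (monicPoly (c ∘ suc)) + (x zero + c zero) * divDiff x (monicPoly (c ∘ suc))
  divDiff-monicPoly-step x x-inj c = begin
    divDiff x (monicPoly c)
      ≡⟨ divDiff-cong x (λ z → split z (x zero) (c zero) (P z)) ⟩
    divDiff x (λ z → (z - x zero) * P z + (x zero + c zero) * P z)
      ≡⟨ divDiff-+ x (λ z → (z - x zero) * P z) (λ z → (x zero + c zero) * P z) ⟩
    divDiff x (λ z → (z - x zero) * P z) + divDiff x (λ z → (x zero + c zero) * P z)
      ≡⟨ cong₂ _+_ (divDiff-removeAt x x-inj zero P) (divDiff-*ˡ x (x zero + c zero) P) ⟩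
    divDiff (removeAt x zero) P + (x zero + c zero) * divDiff x P
      ∎
    where
    P = monicPoly (c ∘ suc)
    split : ∀ z a b p → (z + b) * p ≡ (z - a) * p + (a + b) * p
    split = solve-∀ ℚ-ring

  divDiff-monicPoly-< : ∀ {n k} (x : Vector ℚ (suc n)) → Injective _≡_ _≡_ x → (c : Vector ℚ k) → k ℕ.< n →
                        divDiff x (monicPoly c) ≡ 0ℚ
  divDiff-monicPoly-< {suc n} {zero}  x x-inj c k<n = divDiff-one x x-inj
  divDiff-monicPoly-< {suc n} {suc k} x x-inj c (ℕ.s≤s k<n) = begin
    divDiff x (monicPoly c)                                      ≡⟨ divDiff-monicPoly-step x x-inj c ⟩
    divDiff (removeAt x zero) P + (x zero + c zero) * divDiff x P
      ≡⟨ cong₂ (λ u v → u + (x zero + c zero) * v) (divDiff-monicPoly-< (removeAt x zero) (removeAt-injective x x-inj zero) (c ∘ suc) k<n)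
                                                  (divDiff-monicPoly-< x x-inj (c ∘ suc) (ℕ.m<n⇒m<1+n k<n)) ⟩
    0ℚ + (x zero + c zero) * 0ℚ                                  ≡⟨ vanishes (x zero + c zero) ⟩
    0ℚ                                                           ∎
    where
    P = monicPoly (c ∘ suc)
    vanishes : ∀ a → 0ℚ + a * 0ℚ ≡ 0ℚ
    vanishes = solve-∀ ℚ-ring

  divDiff-monicPoly : ∀ {n} (x : Vector ℚ (suc n)) → Injective _≡_ _≡_ x → (c : Vector ℚ n) →
                      divDiff x (monicPoly c) ≡ 1ℚ
  divDiff-monicPoly {zero}  x x-inj c = refl
  divDiff-monicPoly {suc n} x x-inj c = begin
    divDiff x (monicPoly c)                                      ≡⟨ divDiff-monicPoly-step x x-inj c ⟩
    divDiff (removeAt x zero) P + (x zero + c zero) * divDiff x P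
      ≡⟨ cong₂ (λ u v → u + (x zero + c zero) * v) (divDiff-monicPoly (removeAt x zero) (removeAt-injective x x-inj zero) (c ∘ suc))
                                                  (divDiff-monicPoly-< x x-inj (c ∘ suc) (ℕ.n<1+n n)) ⟩
    1ℚ + (x zero + c zero) * 0ℚ                                  ≡⟨ simplify (x zero + c zero) ⟩
    1ℚ                                                           ∎
    where
    P = monicPoly (c ∘ suc)
    simplify : ∀ a → 1ℚ + a * 0ℚ ≡ 1ℚ
    simplify = solve-∀ ℚ-ring

  divDiff-monicPoly-suc : ∀ {n} (x : Vector ℚ (suc n)) → Injective _≡_ _≡_ x → (c : Vector ℚ (suc n)) →
                          divDiff x (monicPoly c) ≡ sum x + sum c
  divDiff-monicPoly-suc {zero}  x x-inj c = simplify (x zero) (c zero)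
    where
    simplify : ∀ a b → ((a + b) * 1ℚ) * 1ℚ + 0ℚ ≡ (a + 0ℚ) + (b + 0ℚ)
    simplify = solve-∀ ℚ-ring
  divDiff-monicPoly-suc {suc n} x x-inj c = begin
    divDiff x (monicPoly c)                                      ≡⟨ divDiff-monicPoly-step x x-inj c ⟩
    divDiff (removeAt x zero) P + (x zero + c zero) * divDiff x P
      ≡⟨ cong₂ (λ u v → u + (x zero + c zero) * v) (divDiff-monicPoly-suc (removeAt x zero) (removeAt-injective x x-inj zero) (c ∘ suc))
                                                  (divDiff-monicPoly x x-inj (c ∘ suc)) ⟩
    (sum (x ∘ suc) + sum (c ∘ suc)) + (x zero + c zero) * 1ℚ     ≡⟨ regroup (x zero) (c zero) (sum (x ∘ suc)) (sum (c ∘ suc)) ⟩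
    sum x + sum c                                                ∎
    where
    P = monicPoly (c ∘ suc)
    regroup : ∀ a b u v → (u + v) + (a + b) * 1ℚ ≡ (a + u) + (b + v)
    regroup = solve-∀ ℚ-ring

  -- Vandermonde determinants and alternants

  -1^_ : ℕ → ℚ
  -1^ zero  = 1ℚ
  -1^ suc k = - (-1^ k)

  -1^-+ : ∀ a b → -1^ (a ℕ.+ b) ≡ -1^ a * -1^ b
  -1^-+ zero    b = sym (ℚ.*-identityˡ (-1^ b))
  -1^-+ (suc a) b = trans (cong -_ (-1^-+ a b)) (ℚ.neg-distribˡ-* (-1^ a) (-1^ b))

  -1^-punchOut : ∀ {n} {a b : Fin (suc n)} (a≢b : a ≢ b) (b≢a : b ≢ a) →
                 -1^ toℕ a * -1^ toℕ (punchOut a≢b) ≡ - (-1^ toℕ b * -1^ toℕ (punchOut b≢a))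
  -1^-punchOut {a = zero}  {zero}  a≢b b≢a = ⊥-elim (a≢b refl)
  -1^-punchOut {suc n} {zero}  {suc b} a≢b b≢a = flip (-1^ toℕ b)
    where
    flip : ∀ s → 1ℚ * s ≡ - (- s * 1ℚ)
    flip = solve-∀ ℚ-ring
  -1^-punchOut {suc n} {suc a} {zero}  a≢b b≢a = flip (-1^ toℕ a)
    where
    flip : ∀ s → - s * 1ℚ ≡ - (1ℚ * s)
    flip = solve-∀ ℚ-ring
  -1^-punchOut {suc n} {suc a} {suc b} a≢b b≢a =
    trans (negate² (-1^ toℕ a) _)
          (trans (-1^-punchOut (a≢b ∘ cong suc) (b≢a ∘ cong suc)) (cong -_ (sym (negate² (-1^ toℕ b) _))))
    where
    negate² : ∀ u v → - u * - v ≡ u * v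
    negate² = solve-∀ ℚ-ring

  vandermonde : ∀ {n} → Vector ℚ n → ℚ
  vandermonde x = ∏< (λ i j → x i - x j)

  vandermonde-cong : ∀ {n} {x y : Vector ℚ n} → x ≗ y → vandermonde x ≡ vandermonde y
  vandermonde-cong x≗y = ∏<-cong (λ i j → cong₂ _-_ (x≗y i) (x≗y j))

  vandermonde-removeAt : ∀ {n} (x : Vector ℚ (suc n)) p →
                         vandermonde x ≡ (-1^ toℕ p * vandermonde (removeAt x p)) * ω′ x p
  vandermonde-removeAt x zero = trans (∏<-suc (λ i j → x i - x j)) (reorder (ω′ x zero) (vandermonde (x ∘ suc)))
    where
    reorder : ∀ a b → a * b ≡ (1ℚ * b) * a
    reorder = solve-∀ ℚ-ring
  vandermonde-removeAt {suc n} x (suc p) = begin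
    vandermonde x
      ≡⟨ ∏<-suc (λ i j → x i - x j) ⟩
    ∏ (λ j → x zero - x (suc j)) * vandermonde (x ∘ suc)
      ≡⟨ cong₂ _*_ (∏-remove {i = p} (λ j → x zero - x (suc j))) (vandermonde-removeAt (x ∘ suc) p) ⟩
    ((x zero - x (suc p)) * R) * ((-1^ toℕ p * W) * ω′ (x ∘ suc) p)
      ≡⟨ reorder (x zero) (x (suc p)) R (-1^ toℕ p) W (ω′ (x ∘ suc) p) ⟩
    (-1^ toℕ (suc p) * (R * W)) * ((x (suc p) - x zero) * ω′ (x ∘ suc) p)
      ≡⟨ cong (λ w → (-1^ toℕ (suc p) * w) * ω′ x (suc p)) (∏<-suc (λ i j → x′ i - x′ j)) ⟨
    (-1^ toℕ (suc p) * vandermonde (removeAt x (suc p))) * ω′ x (suc p)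
      ∎
    where
    x′ = removeAt x (suc p)
    R = ∏ (λ j → x zero - x (suc (punchIn p j)))
    W = vandermonde (removeAt (x ∘ suc) p)
    reorder : ∀ a b r s w o → ((a - b) * r) * ((s * w) * o) ≡ (- s * (r * w)) * ((b - a) * o)
    reorder = solve-∀ ℚ-ring

  vandermonde-collision : ∀ {n} (x : Vector ℚ n) {a b} → a ≢ b → x a ≡ x b → vandermonde x ≡ 0ℚ
  vandermonde-collision {suc n} x {a} {b} a≢b xa≡xb = begin
    vandermonde x      ≡⟨ vandermonde-removeAt x a ⟩
    m * ω′ x a         ≡⟨ cong (m *_) (∏-zero (λ i → x a - removeAt x a i) (punchOut a≢b) factor≡0) ⟩
    m * 0ℚ             ≡⟨ ℚ.*-zeroʳ m ⟩
    0ℚ                 ∎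
    where
    m = -1^ toℕ a * vandermonde (removeAt x a)
    factor≡0 : x a - x (punchIn a (punchOut a≢b)) ≡ 0ℚ
    factor≡0 = trans (cong (λ w → x a - x w) (punchIn-punchOut a≢b))
                     (trans (cong (λ w → x a - w) (sym xa≡xb)) (ℚ.+-inverseʳ (x a)))

  -- Both sides are ± the Vandermonde determinant of x without a and b, times the same product
  -- of differences since x a = x b.
  minor-collision : ∀ {n} (x : Vector ℚ (suc n)) {a b} (a≢b : a ≢ b) → x a ≡ x b →
                    -1^ toℕ a * vandermonde (removeAt x a) ≡ - (-1^ toℕ b * vandermonde (removeAt x b))
  minor-collision {zero}  x {zero} {zero} a≢b _ = ⊥-elim (a≢b refl)
  minor-collision {suc n} x {a} {b} a≢b xa≡xb = begin
    -1^ toℕ a * vandermonde (removeAt x a)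
      ≡⟨ cong (-1^ toℕ a *_) (vandermonde-removeAt (removeAt x a) b′) ⟩
    -1^ toℕ a * ((-1^ toℕ b′ * vandermonde (removeAt (removeAt x a) b′)) * ω′ (removeAt x a) b′)
      ≡⟨ cong₂ (λ u v → -1^ toℕ a * ((-1^ toℕ b′ * u) * v)) (vandermonde-cong (cong x ∘ commute)) same-ω′ ⟩
    -1^ toℕ a * ((-1^ toℕ b′ * W) * Ω)
      ≡⟨ regroup (-1^ toℕ a) (-1^ toℕ b′) W Ω ⟩
    (-1^ toℕ a * -1^ toℕ b′) * (W * Ω)
      ≡⟨ cong (_* (W * Ω)) (-1^-punchOut a≢b b≢a) ⟩
    - (-1^ toℕ b * -1^ toℕ a′) * (W * Ω)
      ≡⟨ regroup′ (-1^ toℕ b) (-1^ toℕ a′) W Ω ⟩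
    - (-1^ toℕ b * ((-1^ toℕ a′ * W) * Ω))
      ≡⟨ cong (λ w → - (-1^ toℕ b * w)) (vandermonde-removeAt (removeAt x b) a′) ⟨
    - (-1^ toℕ b * vandermonde (removeAt x b))
      ∎
    where
    b≢a : b ≢ a
    b≢a = a≢b ∘ sym
    a′ = punchOut b≢a
    b′ = punchOut a≢b
    W = vandermonde (removeAt (removeAt x b) a′)
    Ω = ω′ (removeAt x b) a′
    commute : ∀ k → punchIn a (punchIn b′ k) ≡ punchIn b (punchIn a′ k)
    commute = punchIn-punchOut-comm a≢b b≢a
    same-ω′ : ω′ (removeAt x a) b′ ≡ Ω
    same-ω′ = ∏-cong (λ k → cong₂ _-_ (trans (cong x (punchIn-punchOut a≢b))
                                              (trans (sym xa≡xb) (cong x (sym (punchIn-punchOut b≢a)))))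
                                       (cong x (commute k)))
    regroup : ∀ s t w o → s * ((t * w) * o) ≡ (s * t) * (w * o)
    regroup = solve-∀ ℚ-ring
    regroup′ : ∀ s t w o → - (s * t) * (w * o) ≡ - (s * ((t * w) * o))
    regroup′ = solve-∀ ℚ-ring

  Collision : ∀ {a} {A : Set a} {n} → Vector A n → Set a
  Collision {n = n} x = ∃ λ (i : Fin n) → ∃ λ j → i ≢ j × x i ≡ x j

  injective⊎collision : ∀ {a} {A : Set a} {n} → DecidableEquality A → (x : Vector A n) →
                        Injective _≡_ _≡_ x ⊎ Collision x
  injective⊎collision _≟ᴬ_ x with any? (λ i → any? (λ j → ¬? (i ≟ j) ×-dec (x i ≟ᴬ x j)))
  ... | yes collision    = inj₂ collision
  ... | no no-collision =
    inj₁ λ {i} {j} xi≡xj → decidable-stable (i ≟ j) (λ i≢j → no-collision (i , j , i≢j , xi≡xj))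

  -- The expansion along the last column of the determinant with rows (1, x p, …, x pⁿ⁻¹, G (x p)).
  alternant : ∀ {n} → Vector ℚ (suc n) → (ℚ → ℚ) → ℚ
  alternant x G = ∑[ p < _ ] ((-1^ toℕ p * vandermonde (removeAt x p)) * G (x p))

  signed-minor : ∀ {n} (x : Vector ℚ (suc n)) p → ω′ x p ≢ 0ℚ →
                 -1^ toℕ p * vandermonde (removeAt x p) ≡ vandermonde x * ω′ x p ⁻¹
  signed-minor x p ω′≢0 = begin
    m                              ≡⟨ ℚ.*-identityʳ m ⟨
    m * 1ℚ                         ≡⟨ cong (m *_) (⁻¹-inverseʳ ω′≢0) ⟨
    m * (ω′ x p * ω′ x p ⁻¹)       ≡⟨ ℚ.*-assoc m (ω′ x p) (ω′ x p ⁻¹) ⟨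
    (m * ω′ x p) * ω′ x p ⁻¹       ≡⟨ cong (_* ω′ x p ⁻¹) (vandermonde-removeAt x p) ⟨
    vandermonde x * ω′ x p ⁻¹      ∎
    where
    m = -1^ toℕ p * vandermonde (removeAt x p)

  alternant-injective : ∀ {n} (x : Vector ℚ (suc n)) → Injective _≡_ _≡_ x → ∀ G →
                        alternant x G ≡ vandermonde x * divDiff x G
  alternant-injective x x-inj G = begin
    alternant x G
      ≡⟨ sum-cong-≗ (λ p → cong (_* G (x p)) (signed-minor x p (ω′-≢0 x x-inj p))) ⟩
    ∑[ p < _ ] ((vandermonde x * ω′ x p ⁻¹) * G (x p))
      ≡⟨ sum-cong-≗ (λ p → reorder (vandermonde x) (ω′ x p ⁻¹) (G (x p))) ⟩
    ∑[ p < _ ] (vandermonde x * (G (x p) * ω′ x p ⁻¹))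
      ≡⟨ *-distribˡ-sum (vandermonde x) (λ p → G (x p) * ω′ x p ⁻¹) ⟨
    vandermonde x * divDiff x G
      ∎
    where
    reorder : ∀ v w g → (v * w) * g ≡ v * (g * w)
    reorder = solve-∀ ℚ-ring

  -- The terms p ∉ {a, b} vanish because x without x p still has a collision; the terms a and b cancel.
  alternant-collision : ∀ {n} (x : Vector ℚ (suc n)) → Collision x → ∀ G → alternant x G ≡ 0ℚ
  alternant-collision x (a , b , a≢b , xa≡xb) G = sum-vanishing-off-pair term a≢b off-pair on-pair
    where
    term : Vector ℚ _
    term p = (-1^ toℕ p * vandermonde (removeAt x p)) * G (x p)
    off-pair : ∀ p → p ≢ a → p ≢ b → term p ≡ 0ℚ
    off-pair p p≢a p≢b = trans (cong (λ v → (-1^ toℕ p * v) * G (x p)) V≡0) (vanishes (-1^ toℕ p) (G (x p)))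
      where
      a′ = punchOut p≢a
      b′ = punchOut p≢b
      a′≢b′ : a′ ≢ b′
      a′≢b′ eq = a≢b (trans (sym (punchIn-punchOut p≢a)) (trans (cong (punchIn p) eq) (punchIn-punchOut p≢b)))
      V≡0 : vandermonde (removeAt x p) ≡ 0ℚ
      V≡0 = vandermonde-collision (removeAt x p) a′≢b′
              (trans (cong x (punchIn-punchOut p≢a)) (trans xa≡xb (cong x (sym (punchIn-punchOut p≢b)))))
      vanishes : ∀ s g → (s * 0ℚ) * g ≡ 0ℚ
      vanishes = solve-∀ ℚ-ring
    on-pair : term a + term b ≡ 0ℚ
    on-pair = begin
      term a + term b
        ≡⟨ cong₂ (λ u g → u * g + term b) (minor-collision x a≢b xa≡xb) (cong G xa≡xb) ⟩
      - (-1^ toℕ b * vandermonde (removeAt x b)) * G (x b) + term b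
        ≡⟨ cancel (-1^ toℕ b * vandermonde (removeAt x b)) (G (x b)) ⟩
      0ℚ
        ∎
      where
      cancel : ∀ m g → - m * g + m * g ≡ 0ℚ
      cancel = solve-∀ ℚ-ring

  alternant-eval : ∀ {n} (x : Vector ℚ (suc n)) G r → (Injective _≡_ _≡_ x → divDiff x G ≡ r) →
                   alternant x G ≡ vandermonde x * r
  alternant-eval x G r divDiff≡r with injective⊎collision ℚ._≟_ x
  ... | inj₁ x-inj = trans (alternant-injective x x-inj G) (cong (vandermonde x *_) (divDiff≡r x-inj))
  ... | inj₂ collision@(a , b , a≢b , xa≡xb) = begin
    alternant x G              ≡⟨ alternant-collision x collision G ⟩
    0ℚ                         ≡⟨ ℚ.*-zeroˡ r ⟨
    0ℚ * r                     ≡⟨ cong (_* r) (vandermonde-collision x a≢b xa≡xb) ⟨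
    vandermonde x * r          ∎

  alternant-monicPoly : ∀ {n} (x : Vector ℚ (suc n)) (c : Vector ℚ n) → alternant x (monicPoly c) ≡ vandermonde x
  alternant-monicPoly x c =
    trans (alternant-eval x (monicPoly c) 1ℚ (λ x-inj → divDiff-monicPoly x x-inj c)) (ℚ.*-identityʳ (vandermonde x))

  alternant-monicPoly-suc : ∀ {n} (x c : Vector ℚ (suc n)) →
                            alternant x (monicPoly c) ≡ vandermonde x * (sum x + sum c)
  alternant-monicPoly-suc x c =
    alternant-eval x (monicPoly c) (sum x + sum c) (λ x-inj → divDiff-monicPoly-suc x x-inj c)

  -- Cauchy's determinant

  cauchyDenominator : ∀ {n} → Vector ℚ n → Vector ℚ n → ℚ
  cauchyDenominator x y = ∏ (λ i → ∏ (λ j → x i + y j))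

  cauchy : ∀ {n} → Vector ℚ n → Vector ℚ n → ℚ
  cauchy x y = (vandermonde x * vandermonde y) * cauchyDenominator x y ⁻¹

  cauchyDenominator-removeAt : ∀ {n} (x y : Vector ℚ (suc n)) → (∀ i j → x i + y j ≢ 0ℚ) → ∀ p q →
    cauchyDenominator (removeAt x p) (removeAt y q) ⁻¹
      ≡ cauchyDenominator x y ⁻¹ * (monicPoly (removeAt y q) (x p) * monicPoly x (y q))
  cauchyDenominator-removeAt x y x+y≢0 p q = begin
    M ⁻¹                             ≡⟨ ℚ.*-identityˡ (M ⁻¹) ⟨
    1ℚ * M ⁻¹                        ≡⟨ cong (_* M ⁻¹) (⁻¹-inverseˡ RS≢0) ⟨
    ((R * S) ⁻¹ * (R * S)) * M ⁻¹    ≡⟨ regroup ((R * S) ⁻¹) (R * S) (M ⁻¹) ⟩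
    ((R * S) ⁻¹ * M ⁻¹) * (R * S)    ≡⟨ cong (_* (R * S)) (⁻¹-distrib-* (R * S) M) ⟨
    ((R * S) * M) ⁻¹ * (R * S)       ≡⟨ cong (λ w → w ⁻¹ * (R * S)) (∏²-remove (λ i j → x i + y j) p q) ⟨
    cauchyDenominator x y ⁻¹ * (R * S)
      ≡⟨ cong (λ w → cauchyDenominator x y ⁻¹ * (R * w)) (∏-cong (λ i → ℚ.+-comm (x i) (y q))) ⟩
    cauchyDenominator x y ⁻¹ * (R * monicPoly x (y q))
      ∎
    where
    R = monicPoly (removeAt y q) (x p)
    S = ∏ (λ i → x i + y q)
    M = cauchyDenominator (removeAt x p) (removeAt y q)
    RS≢0 : R * S ≢ 0ℚ
    RS≢0 = *-≢0 (∏-≢0 _ (λ j → x+y≢0 p (punchIn q j))) (∏-≢0 _ (λ i → x+y≢0 i q))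
    regroup : ∀ a b c → (a * b) * c ≡ (a * c) * b
    regroup = solve-∀ ℚ-ring

  cauchy-minorSum : ∀ {n} (x y : Vector ℚ (suc n)) → (∀ i j → x i + y j ≢ 0ℚ) →
    ∑[ p < suc n ] ∑[ q < suc n ] ((-1^ toℕ p * -1^ toℕ q) * cauchy (removeAt x p) (removeAt y q))
      ≡ (sum x + sum y) * cauchy x y
  cauchy-minorSum {n} x y x+y≢0 = begin
    ∑[ p < suc n ] ∑[ q < suc n ] ((-1^ toℕ p * -1^ toℕ q) * cauchy (removeAt x p) (removeAt y q))
      ≡⟨ sum-cong-≗ (λ p → sum-cong-≗ (λ q → expand p q)) ⟩
    ∑[ p < suc n ] ∑[ q < suc n ] (c q * (μ p * monicPoly (removeAt y q) (x p)))
      ≡⟨ ∑-comm (λ p q → c q * (μ p * monicPoly (removeAt y q) (x p))) ⟩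
    ∑[ q < suc n ] ∑[ p < suc n ] (c q * (μ p * monicPoly (removeAt y q) (x p)))
      ≡⟨ sum-cong-≗ (λ q → *-distribˡ-sum (c q) (λ p → μ p * monicPoly (removeAt y q) (x p))) ⟨
    ∑[ q < suc n ] (c q * alternant x (monicPoly (removeAt y q)))
      ≡⟨ sum-cong-≗ (λ q → trans (cong (c q *_) (alternant-monicPoly x (removeAt y q)))
                                 (reorder (Q ⁻¹) (ν q) (monicPoly x (y q)) (vandermonde x))) ⟩
    ∑[ q < suc n ] ((Q ⁻¹ * vandermonde x) * (ν q * monicPoly x (y q)))
      ≡⟨ *-distribˡ-sum (Q ⁻¹ * vandermonde x) (λ q → ν q * monicPoly x (y q)) ⟨
    (Q ⁻¹ * vandermonde x) * alternant y (monicPoly x)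
      ≡⟨ cong ((Q ⁻¹ * vandermonde x) *_) (alternant-monicPoly-suc y x) ⟩
    (Q ⁻¹ * vandermonde x) * (vandermonde y * (sum y + sum x))
      ≡⟨ finish (Q ⁻¹) (vandermonde x) (vandermonde y) (sum x) (sum y) ⟩
    (sum x + sum y) * cauchy x y
      ∎
    where
    Q = cauchyDenominator x y
    μ : Fin (suc n) → ℚ
    μ p = -1^ toℕ p * vandermonde (removeAt x p)
    ν : Fin (suc n) → ℚ
    ν q = -1^ toℕ q * vandermonde (removeAt y q)
    c : Fin (suc n) → ℚ
    c q = Q ⁻¹ * (ν q * monicPoly x (y q))
    regroup : ∀ s t u v d r m → (s * t) * ((u * v) * (d * (r * m))) ≡ (d * ((t * v) * m)) * ((s * u) * r)
    regroup = solve-∀ ℚ-ring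
    expand : ∀ p q → (-1^ toℕ p * -1^ toℕ q) * cauchy (removeAt x p) (removeAt y q)
                   ≡ c q * (μ p * monicPoly (removeAt y q) (x p))
    expand p q = trans (cong (λ w → (-1^ toℕ p * -1^ toℕ q) * ((vandermonde (removeAt x p) * vandermonde (removeAt y q)) * w))
                             (cauchyDenominator-removeAt x y x+y≢0 p q))
                       (regroup (-1^ toℕ p) (-1^ toℕ q) (vandermonde (removeAt x p)) (vandermonde (removeAt y q)) (Q ⁻¹)
                                (monicPoly (removeAt y q) (x p)) (monicPoly x (y q)))
    reorder : ∀ d v m w → (d * (v * m)) * w ≡ (d * w) * (v * m)
    reorder = solve-∀ ℚ-ring
    finish : ∀ d vx vy sx sy → (d * vx) * (vy * (sy + sx)) ≡ (sx + sy) * ((vx * vy) * d)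
    finish = solve-∀ ℚ-ring

  -- Sums over permutations

  extend : ∀ {d} → Fin (suc d) → (Fin d → Fin d) → Fin (suc d) → Fin (suc d)
  extend k σ = k ◂ (punchIn k ∘ σ)

  ◂-cong : ∀ {a} {A : Set a} {n} (k : A) {f g : Vector A n} → f ≗ g → (k ◂ f) ≗ (k ◂ g)
  ◂-cong k f≗g zero    = refl
  ◂-cong k f≗g (suc i) = f≗g i

  injective-cong : ∀ {d m} {f g : Fin d → Fin m} → f ≗ g → Injective _≡_ _≡_ f → Injective _≡_ _≡_ g
  injective-cong f≗g f-inj gi≡gj = f-inj (trans (f≗g _) (trans gi≡gj (sym (f≗g _))))

  injective-◂ : ∀ {d m} (k : Fin m) (f : Fin d → Fin m) →
                Injective _≡_ _≡_ (k ◂ f) ⇔ ((∀ i → f i ≢ k) × Injective _≡_ _≡_ f)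
  injective-◂ {d} k f = mk⇔ to from
    where
    to : Injective _≡_ _≡_ (k ◂ f) → (∀ i → f i ≢ k) × Injective _≡_ _≡_ f
    to inj = (λ i fi≡k → case (inj {zero} {suc i} (sym fi≡k))) , (λ eq → suc-injective (inj eq))
      where
      case : ∀ {i : Fin d} → zero ≡ suc i → ⊥
      case ()
    from : ((∀ i → f i ≢ k) × Injective _≡_ _≡_ f) → Injective _≡_ _≡_ (k ◂ f)
    from (avoid , f-inj) {zero}  {zero}  _   = refl
    from (avoid , f-inj) {zero}  {suc j} eq  = ⊥-elim (avoid j (sym eq))
    from (avoid , f-inj) {suc i} {zero}  eq  = ⊥-elim (avoid i eq)
    from (avoid , f-inj) {suc i} {suc j} eq  = cong suc (f-inj eq)

  avoids-◂ : ∀ {d m} (k c : Fin m) (f : Fin d → Fin m) → (∀ i → (c ◂ f) i ≢ k) ⇔ (c ≢ k × ∀ i → f i ≢ k)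
  avoids-◂ k c f = mk⇔ (λ avoid → avoid zero , avoid ∘ suc) from
    where
    from : c ≢ k × (∀ i → f i ≢ k) → ∀ i → (c ◂ f) i ≢ k
    from (c≢k , avoid) zero    = c≢k
    from (c≢k , avoid) (suc i) = avoid i

  injective-punchIn∘ : ∀ {d m} (k : Fin (suc m)) (g : Fin d → Fin m) →
                       Injective _≡_ _≡_ (punchIn k ∘ g) ⇔ Injective _≡_ _≡_ g
  injective-punchIn∘ k g =
    mk⇔ (λ inj {i} {j} eq → inj (cong (punchIn k) eq)) (λ inj {i} {j} eq → inj (punchIn-injective k (g i) (g j) eq))

  injective? : ∀ {d m} (f : Fin d → Fin m) → Dec (Injective _≡_ _≡_ f)
  injective? f with injective⊎collision _≟_ f
  ... | inj₁ f-inj                  = yes f-inj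
  ... | inj₂ (i , j , i≢j , fi≡fj) = no (λ f-inj → i≢j (f-inj fi≡fj))

  avoids? : ∀ {d m} (k : Fin m) (f : Fin d → Fin m) → Dec (∀ i → f i ≢ k)
  avoids? k f = all? (λ i → ¬? (f i ≟ k))

  and≡true⇔ : ∀ bs → and bs ≡ true ⇔ (∀ {b} → b ∈ bs → b ≡ true)
  and≡true⇔ bs = mk⇔ (to bs) (from bs)
    where
    to : ∀ bs → and bs ≡ true → ∀ {b} → b ∈ bs → b ≡ true
    to (true ∷ bs) all-true (here refl) = refl
    to (true ∷ bs) all-true (there b∈) = to bs all-true b∈
    from : ∀ bs → (∀ {b} → b ∈ bs → b ≡ true) → and bs ≡ true
    from []       _        = refl
    from (b ∷ bs) all-true rewrite all-true (here refl) = from bs (all-true ∘ there)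

  isInjective≡true⇔ : ∀ {d} (f : Fin d → Fin d) → isInjective f ≡ true ⇔ Injective _≡_ _≡_ f
  isInjective≡true⇔ {d} f = mk⇔ to from
    where
    test : Fin d → Fin d → Bool
    test i j = does (i ≟ j) ∨ not (does (f i ≟ f j))
    tests = concatMap (λ i → map (test i) (allFin d)) (allFin d)
    test-∈ : ∀ i j → test i j ∈ tests
    test-∈ i j = ∈-concatMap⁺ (λ i → map (test i) (allFin d)) (lose (∈-allFin i) (∈-map⁺ (test i) (∈-allFin j)))
    to : isInjective f ≡ true → Injective _≡_ _≡_ f
    to all-true {i} {j} fi≡fj with i ≟ j | Equivalence.to (and≡true⇔ tests) all-true (test-∈ i j)
    ... | yes i≡j | _ = i≡j
    ... | no _    | passes rewrite dec-true (f i ≟ f j) fi≡fj with () ← passes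
    test-true : Injective _≡_ _≡_ f → ∀ i j → test i j ≡ true
    test-true f-inj i j with i ≟ j
    ... | yes _  = refl
    ... | no i≢j rewrite dec-false (f i ≟ f j) (i≢j ∘ f-inj) = refl
    from : Injective _≡_ _≡_ f → isInjective f ≡ true
    from f-inj = Equivalence.from (and≡true⇔ tests) case-∈
      where
      case-∈ : ∀ {b} → b ∈ tests → b ≡ true
      case-∈ b∈ with i , b∈row ← satisfied (∈-concatMap⁻ (λ i → map (test i) (allFin d)) {xs = allFin d} b∈)
                with j , _ , refl ← ∈-map⁻ (test i) b∈row = test-true f-inj i j

  does-isInjective≟true : ∀ {d} (f : Fin d → Fin d) → does (isInjective f Bool.≟ true) ≡ does (injective? f)
  does-isInjective≟true f = does-⇔ (isInjective≡true⇔ f) (isInjective f Bool.≟ true) (injective? f)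

  sumOver-allFunctions-suc : ∀ d m F →
                             sumOver (allFunctions (suc d) m) F ≡ ∑[ k < m ] sumOver (allFunctions d m) (λ f → F (k ◂ f))
  sumOver-allFunctions-suc d m F = begin
    sumOver (allFunctions (suc d) m) F
      ≡⟨ sumOver-concatMap (λ k → map (k ◂_) (allFunctions d m)) (allFin m) F ⟩
    sumOver (allFin m) (λ k → sumOver (map (k ◂_) (allFunctions d m)) F)
      ≡⟨ sumOver-allFin m (λ k → sumOver (map (k ◂_) (allFunctions d m)) F) ⟩
    ∑[ k < m ] sumOver (map (k ◂_) (allFunctions d m)) F
      ≡⟨ sum-cong-≗ (λ k → sumOver-map (k ◂_) (allFunctions d m) F) ⟩
    ∑[ k < m ] sumOver (allFunctions d m) (λ f → F (k ◂ f))
      ∎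

  sumOver-avoiding : ∀ d {m} (k : Fin (suc m)) (G : (Fin d → Fin (suc m)) → ℚ) → (∀ {f g} → f ≗ g → G f ≡ G g) →
    sumOver (allFunctions d (suc m)) (λ f → if does (avoids? k f) then G f else 0ℚ)
      ≡ sumOver (allFunctions d m) (λ g → G (punchIn k ∘ g))
  sumOver-avoiding zero {m} k G G-cong = cong (_+ 0ℚ) (base _ _)
    where
    base : ∀ (f : Fin zero → Fin (suc m)) (g : Fin zero → Fin m) →
           (if does (avoids? k f) then G f else 0ℚ) ≡ G (punchIn k ∘ g)
    base f g rewrite dec-true (avoids? k f) (λ ()) = G-cong (λ ())
  sumOver-avoiding (suc d) {m} k G G-cong = begin
    sumOver (allFunctions (suc d) (suc m)) (λ f → if does (avoids? k f) then G f else 0ℚ)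
      ≡⟨ sumOver-allFunctions-suc d (suc m) (λ f → if does (avoids? k f) then G f else 0ℚ) ⟩
    ∑[ c < suc m ] sumOver (allFunctions d (suc m)) (λ f → if does (avoids? k (c ◂ f)) then G (c ◂ f) else 0ℚ)
      ≡⟨ sum-cong-≗ (λ c → sumOver-cong-∈ (allFunctions d (suc m)) (λ {f} _ → split c f)) ⟩
    ∑[ c < suc m ] sumOver (allFunctions d (suc m)) (λ f → if not (does (c ≟ k)) then H c f else 0ℚ)
      ≡⟨ sum-cong-≗ (λ c → sumOver-if (not (does (c ≟ k))) (allFunctions d (suc m)) (H c)) ⟩
    ∑[ c < suc m ] (if not (does (c ≟ k)) then sumOver (allFunctions d (suc m)) (H c) else 0ℚ)
      ≡⟨ sum-except k (λ c → sumOver (allFunctions d (suc m)) (H c)) ⟩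
    ∑[ c < m ] sumOver (allFunctions d (suc m)) (H (punchIn k c))
      ≡⟨ sum-cong-≗ (λ c → sumOver-avoiding d k (G ∘ (punchIn k c ◂_)) (G-cong ∘ ◂-cong (punchIn k c))) ⟩
    ∑[ c < m ] sumOver (allFunctions d m) (λ g → G (punchIn k c ◂ (punchIn k ∘ g)))
      ≡⟨ sum-cong-≗ (λ c → sumOver-cong-∈ (allFunctions d m) (λ {g} _ → G-cong (punchIn-◂ c g))) ⟩
    ∑[ c < m ] sumOver (allFunctions d m) (λ g → G (punchIn k ∘ (c ◂ g)))
      ≡⟨ sumOver-allFunctions-suc d m (λ g → G (punchIn k ∘ g)) ⟨
    sumOver (allFunctions (suc d) m) (λ g → G (punchIn k ∘ g))
      ∎
    where
    H : Fin (suc m) → (Fin d → Fin (suc m)) → ℚ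
    H c f = if does (avoids? k f) then G (c ◂ f) else 0ℚ
    split : ∀ c f → (if does (avoids? k (c ◂ f)) then G (c ◂ f) else 0ℚ) ≡ (if not (does (c ≟ k)) then H c f else 0ℚ)
    split c f = trans (cong (λ b → if b then G (c ◂ f) else 0ℚ)
                            (does-⇔ (avoids-◂ k c f) (avoids? k (c ◂ f)) (¬? (c ≟ k) ×-dec avoids? k f)))
                      (if-∧ (not (does (c ≟ k))) (does (avoids? k f)) (G (c ◂ f)))
    punchIn-◂ : ∀ c g → (punchIn k c ◂ (punchIn k ∘ g)) ≗ (punchIn k ∘ (c ◂ g))
    punchIn-◂ c g zero    = refl
    punchIn-◂ c g (suc i) = refl

  sumOver-Sym : ∀ d F → sumOver (Sym d) F ≡ sumOver (allFunctions d d) (λ f → if does (injective? f) then F f else 0ℚ)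
  sumOver-Sym d F =
    trans (sumOver-filter (λ f → isInjective f Bool.≟ true) (allFunctions d d) F)
          (sumOver-cong-∈ (allFunctions d d) (λ {f} _ → cong (λ b → if b then F f else 0ℚ) (does-isInjective≟true f)))

  sumOver-Sym-suc : ∀ d (F : (Fin (suc d) → Fin (suc d)) → ℚ) → (∀ {σ τ} → σ ≗ τ → F σ ≡ F τ) →
                    sumOver (Sym (suc d)) F ≡ ∑[ k < suc d ] sumOver (Sym d) (F ∘ extend k)
  sumOver-Sym-suc d F F-cong = begin
    sumOver (Sym (suc d)) F
      ≡⟨ sumOver-Sym (suc d) F ⟩
    sumOver (allFunctions (suc d) (suc d)) (λ f → [ injective? f ] F f)
      ≡⟨ sumOver-allFunctions-suc d (suc d) (λ f → [ injective? f ] F f) ⟩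
    ∑[ k < suc d ] sumOver (allFunctions d (suc d)) (λ f → [ injective? (k ◂ f) ] F (k ◂ f))
      ≡⟨ sum-cong-≗ (λ k → sumOver-cong-∈ (allFunctions d (suc d)) (λ {f} _ → split k f)) ⟩
    ∑[ k < suc d ] sumOver (allFunctions d (suc d)) (λ f → [ avoids? k f ] G k f)
      ≡⟨ sum-cong-≗ (λ k → sumOver-avoiding d k (G k) (G-cong k)) ⟩
    ∑[ k < suc d ] sumOver (allFunctions d d) (λ g → [ injective? (punchIn k ∘ g) ] F (extend k g))
      ≡⟨ sum-cong-≗ (λ k → sumOver-cong-∈ (allFunctions d d) (λ {g} _ → cong (λ b → if b then F (extend k g) else 0ℚ)
           (does-⇔ (injective-punchIn∘ k g) (injective? (punchIn k ∘ g)) (injective? g)))) ⟩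
    ∑[ k < suc d ] sumOver (allFunctions d d) (λ g → [ injective? g ] F (extend k g))
      ≡⟨ sum-cong-≗ (λ k → sumOver-Sym d (F ∘ extend k)) ⟨
    ∑[ k < suc d ] sumOver (Sym d) (F ∘ extend k)
      ∎
    where
    [_]_ : ∀ {P : Set} → Dec P → ℚ → ℚ
    [ P? ] x = if does P? then x else 0ℚ
    G : Fin (suc d) → (Fin d → Fin (suc d)) → ℚ
    G k f = [ injective? f ] F (k ◂ f)
    G-cong : ∀ k {f g} → f ≗ g → G k f ≡ G k g
    G-cong k {f} {g} f≗g = cong₂ (λ b x → if b then x else 0ℚ)
      (does-⇔ (mk⇔ (injective-cong f≗g) (injective-cong (sym ∘ f≗g))) (injective? f) (injective? g))
      (F-cong (◂-cong k f≗g))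
    split : ∀ k f → [ injective? (k ◂ f) ] F (k ◂ f) ≡ [ avoids? k f ] G k f
    split k f = trans (cong (λ b → if b then F (k ◂ f) else 0ℚ)
                            (does-⇔ (injective-◂ k f) (injective? (k ◂ f)) (avoids? k f ×-dec injective? f)))
                      (if-∧ (does (avoids? k f)) (does (injective? f)) (F (k ◂ f)))

  sumOver-Sym²-suc : ∀ n (F : (σ τ : Fin (suc n) → Fin (suc n)) → ℚ) →
    (∀ {σ σ′ τ τ′} → σ ≗ σ′ → τ ≗ τ′ → F σ τ ≡ F σ′ τ′) →
    sumOver (Sym (suc n)) (λ σ → sumOver (Sym (suc n)) (F σ))
      ≡ ∑[ p < suc n ] ∑[ q < suc n ] sumOver (Sym n) (λ σ → sumOver (Sym n) (λ τ → F (extend p σ) (extend q τ)))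
  sumOver-Sym²-suc n F F-cong = begin
    sumOver (Sym (suc n)) (λ σ → sumOver (Sym (suc n)) (F σ))
      ≡⟨ sumOver-cong-∈ (Sym (suc n)) (λ {σ} _ → sumOver-Sym-suc n (F σ) (F-cong (λ _ → refl))) ⟩
    sumOver (Sym (suc n)) G
      ≡⟨ sumOver-Sym-suc n G G-cong ⟩
    ∑[ p < suc n ] sumOver (Sym n) (λ σ → ∑[ q < suc n ] sumOver (Sym n) (λ τ → F (extend p σ) (extend q τ)))
      ≡⟨ sum-cong-≗ (λ p → sumOver-∑-comm (Sym n) (λ σ q → sumOver (Sym n) (λ τ → F (extend p σ) (extend q τ)))) ⟩
    ∑[ p < suc n ] ∑[ q < suc n ] sumOver (Sym n) (λ σ → sumOver (Sym n) (λ τ → F (extend p σ) (extend q τ)))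
      ∎
    where
    G : (Fin (suc n) → Fin (suc n)) → ℚ
    G σ = ∑[ q < suc n ] sumOver (Sym n) (λ τ → F σ (extend q τ))
    G-cong : ∀ {σ σ′} → σ ≗ σ′ → G σ ≡ G σ′
    G-cong σ≗σ′ = sum-cong-≗ (λ q → sumOver-cong-∈ (Sym n) (λ {τ} _ → F-cong {τ = extend q τ} σ≗σ′ (λ _ → refl)))

  allFunctions-complete : ∀ d m (f : Fin d → Fin m) → ∃ λ g → g ∈ allFunctions d m × g ≗ f
  allFunctions-complete zero    m f = _ , here refl , λ ()
  allFunctions-complete (suc d) m f with g , g∈ , g≗f ← allFunctions-complete d m (f ∘ suc) =
    f zero ◂ g , ∈-concatMap⁺ (λ k → map (k ◂_) (allFunctions d m)) (lose (∈-allFin (f zero)) f₀◂g∈) , f≗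
    where
    f₀◂g∈ : f zero ◂ g ∈ map (f zero ◂_) (allFunctions d m)
    f₀◂g∈ = ∈-map⁺ (f zero ◂_) g∈
    f≗ : (f zero ◂ g) ≗ f
    f≗ zero    = refl
    f≗ (suc i) = g≗f i

  Sym-injective : ∀ {d} {σ : Fin d → Fin d} → σ ∈ Sym d → Injective _≡_ _≡_ σ
  Sym-injective {d} σ∈ =
    Equivalence.to (isInjective≡true⇔ _) (proj₂ (∈-filter⁻ (λ f → isInjective f Bool.≟ true) {xs = allFunctions d d} σ∈))

  Sym-complete : ∀ {d} (f : Fin d → Fin d) → Injective _≡_ _≡_ f → ∃ λ σ → σ ∈ Sym d × σ ≗ f
  Sym-complete {d} f f-inj with σ , σ∈ , σ≗f ← allFunctions-complete d d f =
    σ , ∈-filter⁺ (λ g → isInjective g Bool.≟ true) σ∈ σ-passes , σ≗f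
    where
    σ-passes : isInjective σ ≡ true
    σ-passes = Equivalence.from (isInjective≡true⇔ σ) (injective-cong (sym ∘ σ≗f) f-inj)

  extend-injective : ∀ {d} k (σ : Fin d → Fin d) → Injective _≡_ _≡_ σ → Injective _≡_ _≡_ (extend k σ)
  extend-injective k σ σ-inj = Equivalence.from (injective-◂ k (punchIn k ∘ σ))
    ((λ i → punchInᵢ≢i k (σ i)) , Equivalence.from (injective-punchIn∘ k σ) σ-inj)

  -- Signs of permutations

  module ℕSums = FiniteSums ℕ.+-0-commutativeMonoid

  import Algebra.Properties.CommutativeMonoid.Sum ℕ.+-0-commutativeMonoid as ℕ∑

  indicator : Bool → ℕ
  indicator b = if b then 1 else 0

  isInversion : ∀ {d m} → (Fin d → Fin m) → Fin d → Fin d → ℕ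
  isInversion σ i j = if does (i <? j) then indicator (does (σ j <? σ i)) else 0

  inversions≡∑ : ∀ {d} (σ : Fin d → Fin d) → inversions σ ≡ ℕ∑.sum (λ i → ℕ∑.sum (isInversion σ i))
  inversions≡∑ {d} σ = begin
    inversions σ
      -- length xs is definitionally sumOver xs (λ _ → 1).
      ≡⟨ ℕSums.sumOver-filter Q? (filter P? pairs) (λ _ → 1) ⟩
    ℕSums.sumOver (filter P? pairs) (λ p → indicator (does (Q? p)))
      ≡⟨ ℕSums.sumOver-filter P? pairs (λ p → indicator (does (Q? p))) ⟩
    ℕSums.sumOver pairs (λ (i , j) → isInversion σ i j)
      ≡⟨ ℕSums.sumOver-concatMap (λ i → map (i ,_) (allFin d)) (allFin d) (λ (i , j) → isInversion σ i j) ⟩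
    ℕSums.sumOver (allFin d) (λ i → ℕSums.sumOver (map (i ,_) (allFin d)) (λ (i , j) → isInversion σ i j))
      ≡⟨ ℕSums.sumOver-allFin d _ ⟩
    ℕ∑.sum (λ i → ℕSums.sumOver (map (i ,_) (allFin d)) (λ (i , j) → isInversion σ i j))
      ≡⟨ ℕ∑.sum-cong-≗ (λ i → trans (ℕSums.sumOver-map (i ,_) (allFin d) _) (ℕSums.sumOver-allFin d (isInversion σ i))) ⟩
    ℕ∑.sum (λ i → ℕ∑.sum (isInversion σ i))
      ∎
    where
    pairs = concatMap (λ i → map (i ,_) (allFin d)) (allFin d)
    P? : (p : Fin d × Fin d) → Dec (proj₁ p Fin.< proj₂ p)
    P? (i , j) = i <? j
    Q? : (p : Fin d × Fin d) → Dec (σ (proj₂ p) Fin.< σ (proj₁ p))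
    Q? (i , j) = σ j <? σ i

  inversions-cong : ∀ {d} {σ τ : Fin d → Fin d} → σ ≗ τ → inversions σ ≡ inversions τ
  inversions-cong {σ = σ} {τ} σ≗τ = begin
    inversions σ                              ≡⟨ inversions≡∑ σ ⟩
    ℕ∑.sum (λ i → ℕ∑.sum (isInversion σ i))   ≡⟨ ℕ∑.sum-cong-≗ (λ i → ℕ∑.sum-cong-≗ (λ j → same-test i j)) ⟩
    ℕ∑.sum (λ i → ℕ∑.sum (isInversion τ i))   ≡⟨ inversions≡∑ τ ⟨
    inversions τ                              ∎
    where
    same-test : ∀ i j → isInversion σ i j ≡ isInversion τ i j
    same-test i j = cong₂ (λ a b → if does (i <? j) then indicator (does (a <? b)) else 0) (σ≗τ j) (σ≗τ i)

  punchIn-<? : ∀ {n} k (a b : Fin n) → does (punchIn k a <? punchIn k b) ≡ does (a <? b)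
  punchIn-<? zero    a       b       = refl
  punchIn-<? (suc k) zero    zero    = refl
  punchIn-<? (suc k) zero    (suc b) = refl
  punchIn-<? (suc k) (suc a) zero    = refl
  punchIn-<? (suc k) (suc a) (suc b) = punchIn-<? k a b

  count-punchIn-below : ∀ {n} (k : Fin (suc n)) → ℕ∑.sum (λ x → indicator (does (punchIn k x <? k))) ≡ toℕ k
  count-punchIn-below {zero}  zero    = refl
  count-punchIn-below {suc n} zero    = ℕ∑.sum-replicate-zero n
  count-punchIn-below {suc n} (suc k) = cong suc (count-punchIn-below k)

  -- The pairs (0, j) contribute one inversion for each j with punchIn k (σ j) < k, that is,
  -- toℕ k of them since σ is a bijection.
  inversions-extend : ∀ {d} k (σ : Fin d → Fin d) → Injective _≡_ _≡_ σ →
                      inversions (extend k σ) ≡ toℕ k ℕ.+ inversions σ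
  inversions-extend {d} k σ σ-inj = begin
    inversions (extend k σ)
      ≡⟨ inversions≡∑ (extend k σ) ⟩
    ℕ∑.sum (below ∘ σ) ℕ.+ ℕ∑.sum (λ i → ℕ∑.sum (isInversion (punchIn k ∘ σ) i))
      ≡⟨ cong₂ ℕ._+_ (ℕSums.sum-reindex σ σ-inj below)
                     (ℕ∑.sum-cong-≗ (λ i → ℕ∑.sum-cong-≗ (λ j → cong (λ b → if does (i <? j) then indicator b else 0)
                                                                      (punchIn-<? k (σ j) (σ i))))) ⟩
    ℕ∑.sum below ℕ.+ ℕ∑.sum (λ i → ℕ∑.sum (isInversion σ i))
      ≡⟨ cong₂ ℕ._+_ (count-punchIn-below k) (sym (inversions≡∑ σ)) ⟩
    toℕ k ℕ.+ inversions σ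
      ∎
    where
    below : Fin d → ℕ
    below x = indicator (does (punchIn k x <? k))

  toℚ-sgn : ∀ {d} (σ : Fin d → Fin d) → toℚ (sgn σ) ≡ -1^ inversions σ
  toℚ-sgn σ = toℚ-power (inversions σ)
    where
    toℚ-power : ∀ k → toℚ ((ℤ.- ℤ.+ 1) ℤ.^ k) ≡ -1^ k
    toℚ-power zero    = refl
    toℚ-power (suc k) = trans (toℚ-* (ℤ.- ℤ.+ 1) ((ℤ.- ℤ.+ 1) ℤ.^ k))
                              (trans (cong (toℚ (ℤ.- ℤ.+ 1) *_) (toℚ-power k)) (negate (-1^ k)))
      where
      negate : ∀ s → - 1ℚ * s ≡ - s
      negate = solve-∀ ℚ-ring

  toℚ-sgn-extend : ∀ {d} k (σ : Fin d → Fin d) → Injective _≡_ _≡_ σ →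
                   toℚ (sgn (extend k σ)) ≡ -1^ toℕ k * toℚ (sgn σ)
  toℚ-sgn-extend k σ σ-inj = begin
    toℚ (sgn (extend k σ))           ≡⟨ toℚ-sgn (extend k σ) ⟩
    -1^ inversions (extend k σ)      ≡⟨ cong -1^_ (inversions-extend k σ σ-inj) ⟩
    -1^ (toℕ k ℕ.+ inversions σ)     ≡⟨ -1^-+ (toℕ k) (inversions σ) ⟩
    -1^ toℕ k * -1^ inversions σ     ≡⟨ cong (-1^ toℕ k *_) (toℚ-sgn σ) ⟨
    -1^ toℕ k * toℚ (sgn σ)          ∎

  prodℚ≡∏ : ∀ n f → prodℚ n f ≡ ∏ f
  prodℚ≡∏ zero    f = refl
  prodℚ≡∏ (suc n) f = cong (f zero *_) (prodℚ≡∏ n (f ∘ suc))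

  toℚ-sumℤ : ∀ n f → toℚ (sumℤ n f) ≡ ∑[ i < n ] toℚ (f i)
  toℚ-sumℤ zero    f = refl
  toℚ-sumℤ (suc n) f = trans (toℚ-+ (f zero) _) (cong (toℚ (f zero) +_) (toℚ-sumℤ n (f ∘ suc)))

  toℚ-prodℤ : ∀ n f → toℚ (prodℤ n f) ≡ ∏ (toℚ ∘ f)
  toℚ-prodℤ zero    f = refl
  toℚ-prodℤ (suc n) f = trans (toℚ-* (f zero) _) (cong (toℚ (f zero) *_) (toℚ-prodℤ n (f ∘ suc)))

  toℚ-prodLtℤ : ∀ d g → toℚ (prodLtℤ d g) ≡ ∏< (λ i j → toℚ (g i j))
  toℚ-prodLtℤ d g =
    trans (toℚ-prodℤ d _) (∏-cong (λ i → trans (toℚ-prodℤ d _) (∏-cong (λ j → toℚ-if (does (i <? j)) (g i j)))))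
    where
    toℚ-if : ∀ b a → toℚ (if b then a else ℤ.+ 1) ≡ (if b then toℚ a else 1ℚ)
    toℚ-if true  a = refl
    toℚ-if false a = refl

  toℚ-ℕ : ∀ n → toℚ (ℤ.+ n) ≡ ∑[ i < n ] 1ℚ
  toℚ-ℕ zero    = refl
  toℚ-ℕ (suc n) = trans (toℚ-+ (ℤ.+ 1) (ℤ.+ n)) (cong (1ℚ +_) (toℚ-ℕ n))

  sumℤ-cong : ∀ n {f g : Fin n → ℤ} → f ≗ g → sumℤ n f ≡ sumℤ n g
  sumℤ-cong zero    f≗g = refl
  sumℤ-cong (suc n) f≗g = cong₂ ℤ._+_ (f≗g zero) (sumℤ-cong n (f≗g ∘ suc))

  shift : ∀ {n} → (Fin n → ℤ) → Vector ℚ n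
  shift t j = 1ℚ + toℚ (t j)

  toℚ-1+s+t : ∀ a b → toℚ (ℤ.+ 1 ℤ.+ a ℤ.+ b) ≡ toℚ a + (1ℚ + toℚ b)
  toℚ-1+s+t a b =
    trans (toℚ-+ (ℤ.+ 1 ℤ.+ a) b) (trans (cong (_+ toℚ b) (toℚ-+ (ℤ.+ 1) a)) (regroup (toℚ a) (toℚ b)))
    where
    regroup : ∀ a b → (1ℚ + a) + b ≡ a + (1ℚ + b)
    regroup = solve-∀ ℚ-ring

  den-cong : ∀ d s t {σ σ′ τ τ′ : Fin d → Fin d} → σ ≗ σ′ → τ ≗ τ′ →
             ∀ i → den d s t σ τ i ≡ den d s t σ′ τ′ i
  den-cong d s t σ≗σ′ τ≗τ′ i = cong (λ w → ℤ.+ (d ℕ.∸ toℕ i) ℤ.+ w) (sumℤ-cong d (λ j →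
    cong (λ w → if does (i ≤? j) then w else ℤ.+ 0) (cong₂ ℤ._+_ (cong s (σ≗σ′ j)) (cong t (τ≗τ′ j)))))

  toℚ-den-zero : ∀ n s t (σ τ : Fin (suc n) → Fin (suc n)) → Injective _≡_ _≡_ σ → Injective _≡_ _≡_ τ →
                 toℚ (den (suc n) s t σ τ zero) ≡ sum (toℚ ∘ s) + sum (shift t)
  toℚ-den-zero n s t σ τ σ-inj τ-inj = begin
    toℚ (ℤ.+ suc n ℤ.+ sumℤ (suc n) (λ j → s (σ j) ℤ.+ t (τ j)))
      ≡⟨ toℚ-+ (ℤ.+ suc n) (sumℤ (suc n) (λ j → s (σ j) ℤ.+ t (τ j))) ⟩
    toℚ (ℤ.+ suc n) + toℚ (sumℤ (suc n) (λ j → s (σ j) ℤ.+ t (τ j)))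
      ≡⟨ cong₂ _+_ (toℚ-ℕ (suc n)) (toℚ-sumℤ (suc n) (λ j → s (σ j) ℤ.+ t (τ j))) ⟩
    N + ∑[ j < suc n ] toℚ (s (σ j) ℤ.+ t (τ j))
      ≡⟨ cong (N +_) (trans (sum-cong-≗ (λ j → toℚ-+ (s (σ j)) (t (τ j))))
                            (∑-distrib-+ (toℚ ∘ s ∘ σ) (toℚ ∘ t ∘ τ))) ⟩
    N + (sum (toℚ ∘ s ∘ σ) + sum (toℚ ∘ t ∘ τ))
      ≡⟨ cong₂ (λ u v → N + (u + v)) (sum-reindex σ σ-inj (toℚ ∘ s)) (sum-reindex τ τ-inj (toℚ ∘ t)) ⟩
    N + (sum (toℚ ∘ s) + sum (toℚ ∘ t))
      ≡⟨ regroup N (sum (toℚ ∘ s)) (sum (toℚ ∘ t)) ⟩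
    sum (toℚ ∘ s) + (N + sum (toℚ ∘ t))
      ≡⟨ cong (sum (toℚ ∘ s) +_) (∑-distrib-+ (λ _ → 1ℚ) (toℚ ∘ t)) ⟨
    sum (toℚ ∘ s) + sum (shift t)
      ∎
    where
    N = ∑[ j < suc n ] 1ℚ
    regroup : ∀ a b c → a + (b + c) ≡ b + (a + c)
    regroup = solve-∀ ℚ-ring

  den-extend-suc : ∀ n s t p q (σ τ : Fin n → Fin n) i →
                   den (suc n) s t (extend p σ) (extend q τ) (suc i) ≡ den n (removeAt s p) (removeAt t q) σ τ i
  den-extend-suc n s t p q σ τ i = cong (λ w → ℤ.+ (n ℕ.∸ toℕ i) ℤ.+ w) (trans (ℤ.+-identityˡ _) (sumℤ-cong n (λ j →
    cong (λ b → if b then s (punchIn p (σ j)) ℤ.+ t (punchIn q (τ j)) else ℤ.+ 0) (suc-≤? i j))))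
    where
    suc-≤? : ∀ {m} (i j : Fin m) → does (suc i ≤? suc j) ≡ does (i ≤? j)
    suc-≤? zero    j = refl
    suc-≤? (suc i) j = refl

  term : ∀ d (s t : Fin d → ℤ) (σ τ : Fin d → Fin d) → ℚ
  term d s t σ τ = toℚ (sgn σ ℤ.* sgn τ) * ∏ (λ i → recip (den d s t σ τ i))

  lhs≡sumOver : ∀ d s t → lhs d s t ≡ sumOver (Sym d) (λ σ → sumOver (Sym d) (term d s t σ))
  lhs≡sumOver d s t = begin
    lhs d s t
      ≡⟨ sumOver-concatMap (λ σ → map (term′ σ) (Sym d)) (Sym d) id ⟩
    sumOver (Sym d) (λ σ → sumOver (map (term′ σ) (Sym d)) id)
      ≡⟨ sumOver-cong-∈ (Sym d) (λ {σ} _ → sumOver-map (term′ σ) (Sym d) id) ⟩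
    sumOver (Sym d) (λ σ → sumOver (Sym d) (term′ σ))
      ≡⟨ sumOver-cong-∈ (Sym d) (λ {σ} _ → sumOver-cong-∈ (Sym d) (λ {τ} _ →
           cong (toℚ (sgn σ ℤ.* sgn τ) *_) (prodℚ≡∏ d _))) ⟩
    sumOver (Sym d) (λ σ → sumOver (Sym d) (term d s t σ))
      ∎
    where
    term′ : (σ τ : Fin d → Fin d) → ℚ
    term′ σ τ = toℚ (sgn σ ℤ.* sgn τ) * prodℚ d (λ i → recip (den d s t σ τ i))

  term-cong : ∀ d s t {σ σ′ τ τ′ : Fin d → Fin d} → σ ≗ σ′ → τ ≗ τ′ → term d s t σ τ ≡ term d s t σ′ τ′
  term-cong d s t σ≗σ′ τ≗τ′ = cong₂ _*_
    (cong toℚ (cong₂ (λ a b → (-1ℤ ℤ.^ a) ℤ.* (-1ℤ ℤ.^ b)) (inversions-cong σ≗σ′) (inversions-cong τ≗τ′)))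
    (∏-cong (λ i → cong recip (den-cong d s t σ≗σ′ τ≗τ′ i)))
    where
    -1ℤ = ℤ.- ℤ.+ 1

  term-extend : ∀ n s t p q (σ τ : Fin n → Fin n) → Injective _≡_ _≡_ σ → Injective _≡_ _≡_ τ →
    term (suc n) s t (extend p σ) (extend q τ)
      ≡ ((-1^ toℕ p * -1^ toℕ q) * (sum (toℚ ∘ s) + sum (shift t)) ⁻¹) * term n (removeAt s p) (removeAt t q) σ τ
  term-extend n s t p q σ τ σ-inj τ-inj = begin
    toℚ (sgn σ′ ℤ.* sgn τ′) * (recip (den (suc n) s t σ′ τ′ zero) * ∏ (λ i → recip (den (suc n) s t σ′ τ′ (suc i))))
      ≡⟨ cong₂ _*_ signs (cong₂ _*_ first-factor (∏-cong (λ i → cong recip (den-extend-suc n s t p q σ τ i)))) ⟩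
    ((-1^ toℕ p * toℚ (sgn σ)) * (-1^ toℕ q * toℚ (sgn τ))) * (r * D)
      ≡⟨ regroup (-1^ toℕ p) (toℚ (sgn σ)) (-1^ toℕ q) (toℚ (sgn τ)) r D ⟩
    ((-1^ toℕ p * -1^ toℕ q) * r) * ((toℚ (sgn σ) * toℚ (sgn τ)) * D)
      ≡⟨ cong (λ w → ((-1^ toℕ p * -1^ toℕ q) * r) * (w * D)) (toℚ-* (sgn σ) (sgn τ)) ⟨
    ((-1^ toℕ p * -1^ toℕ q) * r) * term n (removeAt s p) (removeAt t q) σ τ
      ∎
    where
    σ′ = extend p σ
    τ′ = extend q τ
    r = (sum (toℚ ∘ s) + sum (shift t)) ⁻¹
    D = ∏ (λ i → recip (den n (removeAt s p) (removeAt t q) σ τ i))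
    signs : toℚ (sgn σ′ ℤ.* sgn τ′) ≡ (-1^ toℕ p * toℚ (sgn σ)) * (-1^ toℕ q * toℚ (sgn τ))
    signs = trans (toℚ-* (sgn σ′) (sgn τ′)) (cong₂ _*_ (toℚ-sgn-extend p σ σ-inj) (toℚ-sgn-extend q τ τ-inj))
    first-factor : recip (den (suc n) s t σ′ τ′ zero) ≡ r
    first-factor = trans (recip≡toℚ⁻¹ (den (suc n) s t σ′ τ′ zero))
                         (cong _⁻¹ (toℚ-den-zero n s t σ′ τ′ (extend-injective p σ σ-inj) (extend-injective q τ τ-inj)))
    regroup : ∀ a b c e r d → ((a * b) * (c * e)) * (r * d) ≡ ((a * c) * r) * ((b * e) * d)
    regroup = solve-∀ ℚ-ring

  lhs-suc : ∀ n s t → lhs (suc n) s t ≡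
    (sum (toℚ ∘ s) + sum (shift t)) ⁻¹
      * ∑[ p < suc n ] ∑[ q < suc n ] ((-1^ toℕ p * -1^ toℕ q) * lhs n (removeAt s p) (removeAt t q))
  lhs-suc n s t = begin
    lhs (suc n) s t
      ≡⟨ lhs≡sumOver (suc n) s t ⟩
    sumOver (Sym (suc n)) (λ σ → sumOver (Sym (suc n)) (term (suc n) s t σ))
      ≡⟨ sumOver-Sym²-suc n (term (suc n) s t) (term-cong (suc n) s t) ⟩
    ∑[ p < suc n ] ∑[ q < suc n ] sumOver (Sym n) (λ σ → sumOver (Sym n) (λ τ → term (suc n) s t (extend p σ) (extend q τ)))
      ≡⟨ sum-cong-≗ (λ p → sum-cong-≗ (λ q → expand p q)) ⟩
    ∑[ p < suc n ] ∑[ q < suc n ] (r * minor p q)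
      ≡⟨ sum-cong-≗ (λ p → *-distribˡ-sum r (minor p)) ⟨
    ∑[ p < suc n ] (r * ∑[ q < suc n ] minor p q)
      ≡⟨ *-distribˡ-sum r (λ p → ∑[ q < suc n ] minor p q) ⟨
    r * ∑[ p < suc n ] ∑[ q < suc n ] minor p q
      ∎
    where
    r = (sum (toℚ ∘ s) + sum (shift t)) ⁻¹
    minor : Fin (suc n) → Fin (suc n) → ℚ
    minor p q = (-1^ toℕ p * -1^ toℕ q) * lhs n (removeAt s p) (removeAt t q)
    expand : ∀ p q → sumOver (Sym n) (λ σ → sumOver (Sym n) (λ τ → term (suc n) s t (extend p σ) (extend q τ))) ≡ r * minor p q
    expand p q = begin
      sumOver (Sym n) (λ σ → sumOver (Sym n) (λ τ → term (suc n) s t (extend p σ) (extend q τ)))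
        ≡⟨ sumOver-cong-∈ (Sym n) (λ σ∈ → sumOver-cong-∈ (Sym n) (λ τ∈ →
             term-extend n s t p q _ _ (Sym-injective σ∈) (Sym-injective τ∈))) ⟩
      sumOver (Sym n) (λ σ → sumOver (Sym n) (λ τ → c * T σ τ))
        ≡⟨ sumOver-cong-∈ (Sym n) (λ {σ} _ → sumOver-*ˡ c (Sym n) (T σ)) ⟨
      sumOver (Sym n) (λ σ → c * sumOver (Sym n) (T σ))
        ≡⟨ sumOver-*ˡ c (Sym n) (λ σ → sumOver (Sym n) (T σ)) ⟨
      c * sumOver (Sym n) (λ σ → sumOver (Sym n) (T σ))
        ≡⟨ cong (c *_) (lhs≡sumOver n (removeAt s p) (removeAt t q)) ⟨
      c * lhs n (removeAt s p) (removeAt t q)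
        ≡⟨ regroup (-1^ toℕ p * -1^ toℕ q) r (lhs n (removeAt s p) (removeAt t q)) ⟩
      r * minor p q
        ∎
      where
      T = term n (removeAt s p) (removeAt t q)
      c = (-1^ toℕ p * -1^ toℕ q) * r
      regroup : ∀ a b l → (a * b) * l ≡ b * (a * l)
      regroup = solve-∀ ℚ-ring

  rhs≡cauchy : ∀ d s t → rhs d s t ≡ cauchy (toℚ ∘ s) (shift t)
  rhs≡cauchy d s t = cong₂ _*_ vandermondes denominator
    where
    shift-difference : ∀ a b c e → (a - b) * (c - e) ≡ (a - b) * ((1ℚ + c) - (1ℚ + e))
    shift-difference = solve-∀ ℚ-ring
    vandermondes : toℚ (prodLtℤ d (λ i j → (s i ℤ.- s j) ℤ.* (t i ℤ.- t j)))
                   ≡ vandermonde (toℚ ∘ s) * vandermonde (shift t)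
    vandermondes = begin
      toℚ (prodLtℤ d (λ i j → (s i ℤ.- s j) ℤ.* (t i ℤ.- t j)))
        ≡⟨ toℚ-prodLtℤ d _ ⟩
      ∏< (λ i j → toℚ ((s i ℤ.- s j) ℤ.* (t i ℤ.- t j)))
        ≡⟨ ∏<-cong (λ i j → trans (toℚ-* (s i ℤ.- s j) (t i ℤ.- t j))
                            (trans (cong₂ _*_ (toℚ-minus (s i) (s j)) (toℚ-minus (t i) (t j)))
                                   (shift-difference (toℚ (s i)) (toℚ (s j)) (toℚ (t i)) (toℚ (t j))))) ⟩
      ∏< (λ i j → (toℚ (s i) - toℚ (s j)) * (shift t i - shift t j))
        ≡⟨ ∏<-distrib-* (λ i j → toℚ (s i) - toℚ (s j)) (λ i j → shift t i - shift t j) ⟩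
      vandermonde (toℚ ∘ s) * vandermonde (shift t)
        ∎
    denominator : prodℚ d (λ i → prodℚ d (λ j → recip (ℤ.+ 1 ℤ.+ s i ℤ.+ t j)))
                  ≡ cauchyDenominator (toℚ ∘ s) (shift t) ⁻¹
    denominator = begin
      prodℚ d (λ i → prodℚ d (λ j → recip (ℤ.+ 1 ℤ.+ s i ℤ.+ t j)))
        ≡⟨ prodℚ≡∏ d _ ⟩
      ∏ (λ i → prodℚ d (λ j → recip (ℤ.+ 1 ℤ.+ s i ℤ.+ t j)))
        ≡⟨ ∏-cong (λ i → trans (prodℚ≡∏ d _) (∏-cong (λ j → entry i j))) ⟩
      ∏ (λ i → ∏ (λ j → (toℚ (s i) + shift t j) ⁻¹))
        ≡⟨ ∏-cong (λ i → ⁻¹-∏ (λ j → toℚ (s i) + shift t j)) ⟨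
      ∏ (λ i → ∏ (λ j → toℚ (s i) + shift t j) ⁻¹)
        ≡⟨ ⁻¹-∏ (λ i → ∏ (λ j → toℚ (s i) + shift t j)) ⟨
      cauchyDenominator (toℚ ∘ s) (shift t) ⁻¹
        ∎
      where
      entry : ∀ i j → recip (ℤ.+ 1 ℤ.+ s i ℤ.+ t j) ≡ (toℚ (s i) + shift t j) ⁻¹
      entry i j = trans (recip≡toℚ⁻¹ (ℤ.+ 1 ℤ.+ s i ℤ.+ t j)) (cong _⁻¹ (toℚ-1+s+t (s i) (t j)))

  LhsDefined : ∀ d → (s t : Fin d → ℤ) → Set
  LhsDefined d s t = ∀ σ τ → σ ∈ Sym d → τ ∈ Sym d → ∀ i → den d s t σ τ i ≢ ℤ.+ 0

  RhsDefined : ∀ d → (s t : Fin d → ℤ) → Set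
  RhsDefined d s t = ∀ i j → ℤ.+ 1 ℤ.+ s i ℤ.+ t j ≢ ℤ.+ 0

  lhs≡rhs : ∀ d s t → LhsDefined d s t → RhsDefined d s t → lhs d s t ≡ rhs d s t
  lhs≡rhs zero    s t _           _           = refl
  lhs≡rhs (suc n) s t lhs-defined rhs-defined = begin
    lhs (suc n) s t
      ≡⟨ lhs-suc n s t ⟩
    S ⁻¹ * ∑[ p < suc n ] ∑[ q < suc n ] ((-1^ toℕ p * -1^ toℕ q) * lhs n (removeAt s p) (removeAt t q))
      ≡⟨ cong (S ⁻¹ *_) (sum-cong-≗ (λ p → sum-cong-≗ (λ q → cong ((-1^ toℕ p * -1^ toℕ q) *_) (minor p q)))) ⟩
    S ⁻¹ * ∑[ p < suc n ] ∑[ q < suc n ] ((-1^ toℕ p * -1^ toℕ q) * cauchy (removeAt x p) (removeAt y q))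
      ≡⟨ cong (S ⁻¹ *_) (cauchy-minorSum x y x+y≢0) ⟩
    S ⁻¹ * (S * cauchy x y)
      ≡⟨ ⁻¹-*-cancelˡ (cauchy x y) S≢0 ⟩
    cauchy x y
      ≡⟨ rhs≡cauchy (suc n) s t ⟨
    rhs (suc n) s t
      ∎
    where
    x = toℚ ∘ s
    y = shift t
    S = sum x + sum y
    lhs-defined-removeAt : ∀ p q → LhsDefined n (removeAt s p) (removeAt t q)
    lhs-defined-removeAt p q σ τ σ∈ τ∈ i
      with σ′ , σ′∈ , σ′≗ ← Sym-complete (extend p σ) (extend-injective p σ (Sym-injective σ∈))
         | τ′ , τ′∈ , τ′≗ ← Sym-complete (extend q τ) (extend-injective q τ (Sym-injective τ∈))
      = λ den≡0 → lhs-defined σ′ τ′ σ′∈ τ′∈ (suc i)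
                    (trans (den-cong (suc n) s t σ′≗ τ′≗ (suc i)) (trans (den-extend-suc n s t p q σ τ i) den≡0))
    rhs-defined-removeAt : ∀ p q → RhsDefined n (removeAt s p) (removeAt t q)
    rhs-defined-removeAt p q i j = rhs-defined (punchIn p i) (punchIn q j)
    minor : ∀ p q → lhs n (removeAt s p) (removeAt t q) ≡ cauchy (removeAt x p) (removeAt y q)
    minor p q = trans (lhs≡rhs n (removeAt s p) (removeAt t q) (lhs-defined-removeAt p q) (rhs-defined-removeAt p q))
                      (rhs≡cauchy n (removeAt s p) (removeAt t q))
    x+y≢0 : ∀ i j → x i + y j ≢ 0ℚ
    x+y≢0 i j x+y≡0 = rhs-defined i j (toℚ-injective (trans (toℚ-1+s+t (s i) (t j)) x+y≡0))
    S≢0 : S ≢ 0ℚ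
    S≢0 S≡0 with σ , σ∈ , _ ← Sym-complete id id =
      lhs-defined σ σ σ∈ σ∈ zero
        (toℚ-injective (trans (toℚ-den-zero n s t σ σ (Sym-injective σ∈) (Sym-injective σ∈)) S≡0))

open import Data.Nat using (ℕ; _≤_)
open import Data.Integer using (ℤ; +_; _+_)
open import Data.Fin using (Fin)
open import Data.List.Membership.Propositional using (_∈_)
open import Relation.Binary.PropositionalEquality using (_≡_; _≢_)

mainTheorem5 : (d : ℕ) → 1 ≤ d → (s t : Fin d → ℤ) →
    (∀ σ τ → σ ∈ Sym d → τ ∈ Sym d → ∀ i → den d s t σ τ i ≢ + 0) →
    (∀ i j → + 1 + s i + t j ≢ + 0) →
    lhs d s t ≡ rhs d s t
mainTheorem5 d _ = lhs≡rhs d
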